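{- Let $\pi$ be a permutation with $\pi \notin \{1, 12, 21, 132, 213, 231, 312\}$. Then every permutation $\omega \in \operatorname{Av}(\pi)$ is contained (as a pattern) in some indecomposable permutation $\zeta \in \operatorname{Av}(\pi)$.
   Context: Permutations are written in one-line notation. A permutation $\alpha$ is contained in $\beta$ ($\alpha \le \beta$) if $\beta$ has a subsequence whose entries are in the same relative order as the entries of $\alpha$. $\operatorname{Av}(\pi)$ denotes the set of permutations that do not contain $\pi$. For a permutation $\sigma$ of length $k$ and permutations $\tau_1,\dots,\tau_k$, the inflation $\sigma[\tau_1,\dots,\tau_k]$ is obtained by replacing the $i$-th entry of $\sigma$ by a block of entries order-isomorphic to $\tau_i$, the blocks being positioned relative to each other as the entries of $\sigma$. Write $\alpha\oplus\beta = 12[\alpha,\beta]$ and $\alpha\ominus\beta=21[\alpha,\beta]$. A permutation is sum-decomposable if it equals $\alpha\oplus\beta$ with $\alpha,\beta$ nonempty, skew-decomposable if it equals $\alpha\ominus\beta$ with $\alpha,\beta$ nonempty, and indecomposable if it is neither sum-decomposable nor skew-decomposable. -}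

module Defs where

open import Data.Nat using (ℕ; zero; suc; _+_; _<_; _≤_)
open import Data.Fin as F using (Fin; toℕ; splitAt; _↑ˡ_; _↑ʳ_; cast)
open import Data.Sum using (_⊎_; inj₁; inj₂)
open import Data.Product using (Σ; Σ-syntax; ∃; ∃-syntax; _×_; _,_; proj₁; proj₂)
open import Relation.Binary.PropositionalEquality using (_≡_; _≢_)
open import Relation.Nullary using (¬_)
open import Function.Definitions using (Injective)
open import Data.List using (List; []; _∷_)
open import Data.List.Membership.Propositional using (_∈_)
open import Data.Vec using (Vec; lookup; []; _∷_)
open import Function.Bundles using (_⇔_)

-- A permutation of length n in one-line notation: an injective
-- (hence bijective) map Fin n → Fin n; entry i (0-based) is π i + 1.
record Perm : Set where
  constructor perm
  field
    len  : ℕ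
    fun  : Fin len → Fin len
    inj  : Injective _≡_ _≡_ fun
open Perm public

_≈ₚ_ : Perm → Perm → Set
p ≈ₚ q = Σ (len p ≡ len q) λ e → ∀ i → toℕ (fun p i) ≡ toℕ (fun q (cast e i))

_≼_ : Perm → Perm → Set
α ≼ β = Σ (Fin (len α) → Fin (len β)) λ e →
          (∀ i j → i F.< j → e i F.< e j) ×
          (∀ i j → (fun α i F.< fun α j) ⇔ (fun β (e i) F.< fun β (e j)))

Av : Perm → Perm → Set
Av π σ = ¬ (π ≼ σ)

sumFun : ∀ {a b} → (Fin a → Fin a) → (Fin b → Fin b) → Fin (a + b) → Fin (a + b)
sumFun {a} {b} f g i with splitAt a i
... | inj₁ x = f x ↑ˡ b
... | inj₂ y = a ↑ʳ g y

skewFun : ∀ {a b} → (Fin a → Fin a) → (Fin b → Fin b) → Fin (a + b) → Fin (b + a)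
skewFun {a} {b} f g i with splitAt a i
... | inj₁ x = b ↑ʳ f x
... | inj₂ y = g y ↑ˡ a

SumDecomposable : Perm → Set
SumDecomposable σ =
  ∃[ a ] ∃[ b ] Σ (a + b ≡ len σ) λ e →
    0 < a × 0 < b ×
    Σ (Fin a → Fin a) λ f → Injective _≡_ _≡_ f ×
    Σ (Fin b → Fin b) λ g → Injective _≡_ _≡_ g ×
      (∀ i → toℕ (sumFun f g i) ≡ toℕ (fun σ (cast e i)))

SkewDecomposable : Perm → Set
SkewDecomposable σ =
  ∃[ a ] ∃[ b ] Σ (a + b ≡ len σ) λ e →
    0 < a × 0 < b ×
    Σ (Fin a → Fin a) λ f → Injective _≡_ _≡_ f ×
    Σ (Fin b → Fin b) λ g → Injective _≡_ _≡_ g ×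
      (∀ i → toℕ (skewFun f g i) ≡ toℕ (fun σ (cast e i)))

Indecomposable : Perm → Set
Indecomposable σ = ¬ SumDecomposable σ × ¬ SkewDecomposable σ

-- Membership of π in the exceptional set {1,12,21,132,213,231,312},
-- stated as equality of one-line notations (1-based values, as in the paper).
oneLine : ∀ {n} → Vec ℕ n → Perm → Set
oneLine {n} v π = Σ (len π ≡ n) λ e → ∀ i → suc (toℕ (fun π i)) ≡ lookup v (cast e i)

Exceptional : Perm → Set
Exceptional π =
  oneLine (1 ∷ []) π ⊎ oneLine (1 ∷ 2 ∷ []) π ⊎ oneLine (2 ∷ 1 ∷ []) π ⊎
  oneLine (1 ∷ 3 ∷ 2 ∷ []) π ⊎ oneLine (2 ∷ 1 ∷ 3 ∷ []) π ⊎
  oneLine (2 ∷ 3 ∷ 1 ∷ []) π ⊎ oneLine (3 ∷ 1 ∷ 2 ∷ []) π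

-- An indecomposable ω is its own extension, and the complement turns a skew sum
-- into a sum, so let ω = α ⊕ β. Then ζ arises by inserting two new entries either into ω itself or
-- into σ ⊕ τ, where σ and τ are the extensions of α and β given by induction. The two entries are
-- placed, according to how the first and last entries of π compare and whether they are extreme in π,
-- so that ζ is indecomposable and no copy of π in ζ can use them; such a copy then lies in ω, or in
-- σ ⊕ τ, which avoids π when π ends below its start since a copy of π cannot meet both summands.

module Submission where

open import Defs
open import Data.Empty using (⊥; ⊥-elim)
open import Data.Fin as Fin using (Fin; toℕ; fromℕ<; cast)
import Data.Fin.Properties as FP
open import Data.Fin.Patterns using (0F; 1F; 2F)
open import Data.Nat using (ℕ; zero; suc; _+_; _∸_; _<_; _≤_; _>_; z≤n; s≤s; _<?_; _≤?_; _≟_; pred)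
open import Data.Nat.Induction using (<-wellFounded)
open import Data.Nat.Properties
open import Data.Product using (Σ; _×_; _,_; proj₁; proj₂)
open import Data.Sum using (_⊎_; inj₁; inj₂; [_,_])
open import Data.Vec using (_∷_; [])
open import Function using (_∘_)
open import Function.Bundles using (_⇔_; mk⇔; Equivalence)
open import Function.Definitions using (Injective)
open import Induction.WellFounded using (module All)
open import Relation.Binary using (tri<; tri≈; tri>)
import Relation.Binary.Construct.On as On
open import Relation.Binary.PropositionalEquality using (_≡_; _≢_; refl; sym; trans; cong; subst; subst₂; module ≡-Reasoning)
open import Relation.Nullary using (¬_; Dec; yes; no; ¬?; _×-dec_; _→-dec_)
open import Relation.Nullary.Decidable using (map′)

-- ℕ-valued versions of Fin.punchIn / Fin.punchOut: open, resp. close, a gap at a.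

punchIn : ℕ → ℕ → ℕ
punchIn a x with x <? a
... | yes _ = x
... | no _ = suc x

punchIn-< : ∀ {a x} → x < a → punchIn a x ≡ x
punchIn-< {a} {x} x<a with x <? a
... | yes _ = refl
... | no x≮a = ⊥-elim (x≮a x<a)

punchIn-≥ : ∀ {a x} → a ≤ x → punchIn a x ≡ suc x
punchIn-≥ {a} {x} a≤x with x <? a
... | yes x<a = ⊥-elim (<⇒≱ x<a a≤x)
... | no _ = refl

punchIn-cases : ∀ a x → (x < a × punchIn a x ≡ x) ⊎ (a ≤ x × punchIn a x ≡ suc x)
punchIn-cases a x with <-≤-connex x a
... | inj₁ x<a = inj₁ (x<a , punchIn-< x<a)
... | inj₂ a≤x = inj₂ (a≤x , punchIn-≥ a≤x)

punchIn≢ : ∀ a x → punchIn a x ≢ a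
punchIn≢ a x eq with punchIn-cases a x
... | inj₁ (x<a , p) = <⇒≢ x<a (trans (sym p) eq)
... | inj₂ (a≤x , p) = <⇒≢ (s≤s a≤x) (sym (trans (sym p) eq))

punchIn-mono : ∀ a {x y} → x < y → punchIn a x < punchIn a y
punchIn-mono a {x} {y} x<y with punchIn-cases a x | punchIn-cases a y
... | inj₁ (_ , p) | inj₁ (_ , q) rewrite p | q = x<y
... | inj₁ (_ , p) | inj₂ (_ , q) rewrite p | q = m<n⇒m<1+n x<y
... | inj₂ (a≤x , _) | inj₁ (y<a , _) = ⊥-elim (<⇒≱ (<-trans x<y y<a) a≤x)
... | inj₂ (_ , p) | inj₂ (_ , q) rewrite p | q = s≤s x<y

punchIn-cancel : ∀ a {x y} → punchIn a x < punchIn a y → x < y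
punchIn-cancel a {x} {y} lt with <-cmp x y
... | tri< x<y _ _ = x<y
... | tri≈ _ refl _ = ⊥-elim (<-irrefl refl lt)
... | tri> _ _ y<x = ⊥-elim (<-asym lt (punchIn-mono a y<x))

punchIn-injective : ∀ a {x y} → punchIn a x ≡ punchIn a y → x ≡ y
punchIn-injective a {x} {y} eq with <-cmp x y
... | tri< x<y _ _ = ⊥-elim (<⇒≢ (punchIn-mono a x<y) eq)
... | tri≈ _ x≡y _ = x≡y
... | tri> _ _ y<x = ⊥-elim (<⇒≢ (punchIn-mono a y<x) (sym eq))

punchIn-<suc : ∀ a {x m} → x < m → punchIn a x < suc m
punchIn-<suc a {x} x<m with punchIn-cases a x
... | inj₁ (_ , p) rewrite p = m<n⇒m<1+n x<m
... | inj₂ (_ , p) rewrite p = s≤s x<m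

punchIn-≤ : ∀ a x → x ≤ punchIn a x
punchIn-≤ a x with punchIn-cases a x
... | inj₁ (_ , p) = ≤-reflexive (sym p)
... | inj₂ (_ , p) = subst (x ≤_) (sym p) (n≤1+n x)

punchOut : ℕ → ℕ → ℕ
punchOut a q with q <? a
... | yes _ = q
... | no _ = pred q

punchIn-punchOut : ∀ a q → q ≢ a → punchIn a (punchOut a q) ≡ q
punchIn-punchOut a q q≢a with q <? a
... | yes q<a = punchIn-< q<a
punchIn-punchOut a zero q≢a | no q≮a = ⊥-elim (q≢a (sym (n≤0⇒n≡0 (≮⇒≥ q≮a))))
punchIn-punchOut a (suc q) q≢a | no q≮a =
  punchIn-≥ (≤-pred (≤∧≢⇒< (≮⇒≥ q≮a) (q≢a ∘ sym)))

punchOut-punchIn : ∀ a x → punchOut a (punchIn a x) ≡ x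
punchOut-punchIn a x with punchIn-cases a x
... | inj₁ (x<a , p) rewrite p with x <? a
...   | yes _ = refl
...   | no x≮a = ⊥-elim (x≮a x<a)
punchOut-punchIn a x | inj₂ (a≤x , p) rewrite p with suc x <? a
...   | yes x+1<a = ⊥-elim (<⇒≱ (<-trans (n<1+n x) x+1<a) a≤x)
...   | no _ = refl

punchOut-< : ∀ a {q m} → a ≤ m → q < suc m → q ≢ a → punchOut a q < m
punchOut-< a {q} a≤m q<m q≢a with q <? a
... | yes q<a = <-≤-trans q<a a≤m
punchOut-< a {zero} a≤m q<m q≢a | no q≮a = ⊥-elim (q≢a (sym (n≤0⇒n≡0 (≮⇒≥ q≮a))))
punchOut-< a {suc q} a≤m (s≤s q<m) q≢a | no q≮a = q<m

0<⇒suc-pred≡ : ∀ {m} → 0 < m → suc (pred m) ≡ m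
0<⇒suc-pred≡ (s≤s _) = refl

0<⇒pred< : ∀ {m} → 0 < m → pred m < m
0<⇒pred< (s≤s _) = ≤-refl

t<n∸k⇒k+t<n : ∀ {k t n} → k ≤ n → t < n ∸ k → k + t < n
t<n∸k⇒k+t<n {k} {t} k≤n t<n∸k = subst (k + t <_) (m+[n∸m]≡n k≤n) (+-monoʳ-< k t<n∸k)

i<a+b⇒i∸a<b : ∀ a {b i} → a ≤ i → i < a + b → i ∸ a < b
i<a+b⇒i∸a<b a {b} {i} a≤i i<a+b = +-cancelˡ-< a _ _ (subst (_< a + b) (sym (m+[n∸m]≡n a≤i)) i<a+b)

-- Permutations with ℕ-indexed entries, the only size information being the bounds
-- below; this spares all Fin casts in the constructions.
record ℕPerm : Set where
  constructor mkℕPerm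
  field
    size          : ℕ
    val           : ℕ → ℕ
    val<          : ∀ {i} → i < size → val i < size
    val-injective : ∀ {i j} → i < size → j < size → val i ≡ val j → i ≡ j
open ℕPerm public

infix 4 _⊑_

record _⊑_ (p q : ℕPerm) : Set where
  constructor mk⊑
  field
    pos         : ℕ → ℕ
    pos<        : ∀ {i} → i < size p → pos i < size q
    pos-mono    : ∀ {i j} → i < j → j < size p → pos i < pos j
    preserves-< : ∀ {i j} → i < size p → j < size p → val p i < val p j → val q (pos i) < val q (pos j)
    reflects-<  : ∀ {i j} → i < size p → j < size p → val q (pos i) < val q (pos j) → val p i < val p j
open _⊑_ public

⊑-refl : ∀ ω → ω ⊑ ω
⊑-refl ω = mk⊑ (λ i → i) (λ i<n → i<n) (λ i<j _ → i<j) (λ _ _ lt → lt) (λ _ _ lt → lt)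

same-entries⇒⊑ : ∀ {p q} → size p ≡ size q → (∀ {i} → i < size p → val p i ≡ val q i) → p ⊑ q
same-entries⇒⊑ {p} p≡q same = mk⊑ (λ i → i) (subst (_ <_) p≡q) (λ i<j _ → i<j)
  (λ i<n j<n → subst₂ _<_ (same i<n) (same j<n)) (λ i<n j<n → subst₂ _<_ (sym (same i<n)) (sym (same j<n)))

⊑-trans : ∀ {p q r} → p ⊑ q → q ⊑ r → p ⊑ r
⊑-trans h g = mk⊑ (λ i → pos g (pos h i)) (λ i<n → pos< g (pos< h i<n))
  (λ i<j j<n → pos-mono g (pos-mono h i<j j<n) (pos< h j<n))
  (λ i<n j<n lt → preserves-< g (pos< h i<n) (pos< h j<n) (preserves-< h i<n j<n lt))
  (λ i<n j<n lt → reflects-< h i<n j<n (reflects-< g (pos< h i<n) (pos< h j<n) lt))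

module _ {p q : ℕPerm} (h : p ⊑ q) where

  pos-mono-≤ : ∀ {i j} → i ≤ j → j < size p → pos h i ≤ pos h j
  pos-mono-≤ i≤j j<n with m≤n⇒m<n∨m≡n i≤j
  ... | inj₁ i<j = <⇒≤ (pos-mono h i<j j<n)
  ... | inj₂ refl = ≤-refl

  pos-cancel : ∀ {i j} → i < size p → j < size p → pos h i < pos h j → i < j
  pos-cancel {i} {j} i<n j<n lt with <-cmp i j
  ... | tri< i<j _ _ = i<j
  ... | tri≈ _ refl _ = ⊥-elim (<-irrefl refl lt)
  ... | tri> _ _ j<i = ⊥-elim (<-asym lt (pos-mono h j<i i<n))

  pos-injective : ∀ {i j} → i < size p → j < size p → pos h i ≡ pos h j → i ≡ j
  pos-injective {i} {j} i<n j<n eq with <-cmp i j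
  ... | tri< i<j _ _ = ⊥-elim (<⇒≢ (pos-mono h i<j j<n) eq)
  ... | tri≈ _ i≡j _ = i≡j
  ... | tri> _ _ j<i = ⊥-elim (<⇒≢ (pos-mono h j<i i<n) (sym eq))

  pos-≥ : ∀ {i} → i < size p → i ≤ pos h i
  pos-≥ {zero} _ = z≤n
  pos-≥ {suc i} i+1<n = ≤-<-trans (pos-≥ (<-trans (n<1+n i) i+1<n)) (pos-mono h (n<1+n i) i+1<n)

  pos≡0 : ∀ {i} → i < size p → pos h i ≡ 0 → i ≡ 0
  pos≡0 {i} i<n eq = n≤0⇒n≡0 (subst (i ≤_) eq (pos-≥ i<n))

  pos≡last : ∀ {i M m} → size q ≡ suc M → size p ≡ suc m → i < size p → pos h i ≡ M → i ≡ m
  pos≡last {i} {M} {m} q≡ p≡ i<n eq with <-cmp i m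
  ... | tri≈ _ i≡m _ = i≡m
  ... | tri> _ _ m<i = ⊥-elim (<⇒≱ (subst (i <_) p≡ i<n) m<i)
  ... | tri< i<m _ _ = ⊥-elim (<⇒≱ (pos-mono h i<m m<n) (subst (pos h m ≤_) (sym eq) pos-m≤M))
    where
    m<n : m < size p
    m<n = subst (m <_) (sym p≡) (n<1+n m)
    pos-m≤M : pos h m ≤ M
    pos-m≤M = ≤-pred (subst (pos h m <_) q≡ (pos< h m<n))

  pos-between : ∀ {i m} → size p ≡ suc m → i < size p → pos h 0 ≤ pos h i × pos h i ≤ pos h m
  pos-between {i} {m} p≡ i<n =
    pos-mono-≤ z≤n i<n , pos-mono-≤ (≤-pred (subst (i <_) p≡ i<n)) (subst (m <_) (sym p≡) (n<1+n m))

bounded-injective⇒≤ : ∀ {c d} (g : ℕ → ℕ) → (∀ {i} → i < c → g i < d) →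
                      (∀ {i j} → i < c → j < c → g i ≡ g j → i ≡ j) → c ≤ d
bounded-injective⇒≤ {c} {d} g g< g-injective = FP.injective⇒≤ g′-injective
  where
  g′ : Fin c → Fin d
  g′ i = fromℕ< (g< (FP.toℕ<n i))
  g′-injective : Injective _≡_ _≡_ g′
  g′-injective {i} {j} eq = FP.toℕ-injective (g-injective (FP.toℕ<n i) (FP.toℕ<n j)
    (FP.fromℕ<-injective _ _ (g< (FP.toℕ<n i)) (g< (FP.toℕ<n j)) eq))

val-surjective : ∀ ω {v} → v < size ω → Σ ℕ λ i → i < size ω × val ω i ≡ v
val-surjective ω {v} v<n with anyUpTo? (λ i → val ω i ≟ v) (size ω)
... | yes hit = hit
... | no v-missed = ⊥-elim (<⇒≱ (0<⇒pred< 0<n) n≤pred)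
  where
  -- Missing v, the entries fit into size ω ∸ 1 values after closing the gap at v.
  0<n : 0 < size ω
  0<n = ≤-<-trans z≤n v<n
  val≢v : ∀ {i} → i < size ω → val ω i ≢ v
  val≢v i<n eq = v-missed (_ , i<n , eq)
  n≤pred : size ω ≤ pred (size ω)
  n≤pred = bounded-injective⇒≤ (punchOut v ∘ val ω)
    (λ i<n → punchOut-< v (≤-pred (subst (v <_) (sym (0<⇒suc-pred≡ 0<n)) v<n))
                         (subst (val ω _ <_) (sym (0<⇒suc-pred≡ 0<n)) (val< ω i<n)) (val≢v i<n))
    (λ {i} {j} i<n j<n eq → val-injective ω i<n j<n (begin
      val ω i                        ≡⟨ punchIn-punchOut v (val ω i) (val≢v i<n) ⟨
      punchIn v (punchOut v (val ω i)) ≡⟨ cong (punchIn v) eq ⟩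
      punchIn v (punchOut v (val ω j)) ≡⟨ punchIn-punchOut v (val ω j) (val≢v j<n) ⟩
      val ω j                        ∎))
    where open ≡-Reasoning

insertVal : ℕPerm → ℕ → ℕ → ℕ → ℕ
insertVal ω p v q with q ≟ p
... | yes _ = v
... | no _ = punchIn v (val ω (punchOut p q))

insertVal-new : ∀ ω p v → insertVal ω p v p ≡ v
insertVal-new ω p v with p ≟ p
... | yes _ = refl
... | no p≢p = ⊥-elim (p≢p refl)

insertVal-old : ∀ ω p v q → q ≢ p → insertVal ω p v q ≡ punchIn v (val ω (punchOut p q))
insertVal-old ω p v q q≢p with q ≟ p
... | yes q≡p = ⊥-elim (q≢p q≡p)
... | no _ = refl

insertVal-punchIn : ∀ ω p v k → insertVal ω p v (punchIn p k) ≡ punchIn v (val ω k)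
insertVal-punchIn ω p v k = begin
  insertVal ω p v (punchIn p k)                  ≡⟨ insertVal-old ω p v (punchIn p k) (punchIn≢ p k) ⟩
  punchIn v (val ω (punchOut p (punchIn p k)))   ≡⟨ cong (punchIn v ∘ val ω) (punchOut-punchIn p k) ⟩
  punchIn v (val ω k)                            ∎
  where open ≡-Reasoning

insert : (ω : ℕPerm) (p v : ℕ) → p ≤ size ω → v ≤ size ω → ℕPerm
insert ω p v p≤n v≤n = mkℕPerm (suc (size ω)) (insertVal ω p v) insertVal< insertVal-injective
  where
  insertVal< : ∀ {q} → q < suc (size ω) → insertVal ω p v q < suc (size ω)
  insertVal< {q} q<n with q ≟ p
  ... | yes _ = s≤s v≤n
  ... | no q≢p = punchIn-<suc v (val< ω (punchOut-< p p≤n q<n q≢p))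
  insertVal-injective : ∀ {q r} → q < suc (size ω) → r < suc (size ω) →
                        insertVal ω p v q ≡ insertVal ω p v r → q ≡ r
  insertVal-injective {q} {r} q<n r<n eq with q ≟ p | r ≟ p
  ... | yes q≡p | yes r≡p = trans q≡p (sym r≡p)
  ... | yes _ | no _ = ⊥-elim (punchIn≢ v _ (sym eq))
  ... | no _ | yes _ = ⊥-elim (punchIn≢ v _ eq)
  ... | no q≢p | no r≢p = begin
    q                               ≡⟨ punchIn-punchOut p q q≢p ⟨
    punchIn p (punchOut p q)        ≡⟨ cong (punchIn p) (val-injective ω (punchOut-< p p≤n q<n q≢p)
                                         (punchOut-< p p≤n r<n r≢p) (punchIn-injective v eq)) ⟩
    punchIn p (punchOut p r)        ≡⟨ punchIn-punchOut p r r≢p ⟩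
    r                               ∎
    where open ≡-Reasoning

⊑-insert : ∀ ω p v p≤n v≤n → ω ⊑ insert ω p v p≤n v≤n
⊑-insert ω p v _ _ = mk⊑ (punchIn p) (punchIn-<suc p) (λ i<j _ → punchIn-mono p i<j)
  (λ {i} {j} _ _ lt → subst₂ _<_ (sym (insertVal-punchIn ω p v i)) (sym (insertVal-punchIn ω p v j)) (punchIn-mono v lt))
  (λ {i} {j} _ _ lt → punchIn-cancel v (subst₂ _<_ (insertVal-punchIn ω p v i) (insertVal-punchIn ω p v j) lt))

insert-covers : ∀ ω p v p≤n v≤n {q} → q < size (insert ω p v p≤n v≤n) → q ≢ p →
                Σ ℕ λ k → k < size ω × punchIn p k ≡ q
insert-covers ω p v p≤n v≤n {q} q<n q≢p = punchOut p q , punchOut-< p p≤n q<n q≢p , punchIn-punchOut p q q≢p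

⊑-factor : ∀ {π ω ζ} (h : ω ⊑ ζ) (g : π ⊑ ζ) →
           (∀ {i} → i < size π → Σ ℕ λ k → k < size ω × pos h k ≡ pos g i) → π ⊑ ω
⊑-factor {π} {ω} {ζ} h g cover = mk⊑ pos′ pos′< pos′-mono preserves reflects
  where
  pos′ : ℕ → ℕ
  pos′ i with i <? size π
  ... | yes i<n = proj₁ (cover i<n)
  ... | no _ = 0
  pos′-spec : ∀ {i} (i<n : i < size π) → pos′ i < size ω × pos h (pos′ i) ≡ pos g i
  pos′-spec {i} i<n with i <? size π
  ... | yes i<n′ = proj₂ (cover i<n′)
  ... | no i≮n = ⊥-elim (i≮n i<n)
  pos′< : ∀ {i} → i < size π → pos′ i < size ω
  pos′< = proj₁ ∘ pos′-spec
  through : ∀ {i} → i < size π → pos h (pos′ i) ≡ pos g i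
  through = proj₂ ∘ pos′-spec
  val-through : ∀ {i j} → i < size π → j < size π →
                val ζ (pos h (pos′ i)) < val ζ (pos h (pos′ j)) → val ζ (pos g i) < val ζ (pos g j)
  val-through i<n j<n = subst₂ (λ a b → val ζ a < val ζ b) (through i<n) (through j<n)
  val-through⁻ : ∀ {i j} → i < size π → j < size π →
                 val ζ (pos g i) < val ζ (pos g j) → val ζ (pos h (pos′ i)) < val ζ (pos h (pos′ j))
  val-through⁻ i<n j<n = subst₂ (λ a b → val ζ a < val ζ b) (sym (through i<n)) (sym (through j<n))
  pos′-mono : ∀ {i j} → i < j → j < size π → pos′ i < pos′ j
  pos′-mono {i} i<j j<n = pos-cancel h (pos′< i<n) (pos′< j<n)
    (subst₂ _<_ (sym (through i<n)) (sym (through j<n)) (pos-mono g i<j j<n))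
    where
    i<n : i < size π
    i<n = <-trans i<j j<n
  preserves : ∀ {i j} → i < size π → j < size π → val π i < val π j → val ω (pos′ i) < val ω (pos′ j)
  preserves i<n j<n lt = reflects-< h (pos′< i<n) (pos′< j<n) (val-through⁻ i<n j<n (preserves-< g i<n j<n lt))
  reflects : ∀ {i j} → i < size π → j < size π → val ω (pos′ i) < val ω (pos′ j) → val π i < val π j
  reflects i<n j<n lt = reflects-< g i<n j<n (val-through i<n j<n (preserves-< h (pos′< i<n) (pos′< j<n) lt))

-- Entries that cannot be embedded

TwoAbove TwoBelow Above Below : ℕPerm → ℕ → Set
TwoAbove π i = Σ ℕ λ j → Σ ℕ λ j′ → j < size π × j′ < size π × j ≢ j′ × val π i < val π j × val π i < val π j′
TwoBelow π i = Σ ℕ λ j → Σ ℕ λ j′ → j < size π × j′ < size π × j ≢ j′ × val π j < val π i × val π j′ < val π i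
Above π i = Σ ℕ λ j → j < size π × val π i < val π j
Below π i = Σ ℕ λ j → j < size π × val π j < val π i

module _ {π ζ : ℕPerm} (g : π ⊑ ζ) where

  -- Both entries above i would have to land on the single value suc M.
  TwoAbove-avoids-secondMax : ∀ {i M} → size ζ ≡ suc (suc M) → i < size π → val ζ (pos g i) ≡ M →
                              ¬ TwoAbove π i
  TwoAbove-avoids-secondMax {i} {M} ζ≡ i<n vi≡M (j , j′ , j<n , j′<n , j≢j′ , i<j , i<j′) =
    j≢j′ (pos-injective g j<n j′<n (val-injective ζ (pos< g j<n) (pos< g j′<n) (trans (top j<n i<j) (sym (top j′<n i<j′)))))
    where
    top : ∀ {j} → j < size π → val π i < val π j → val ζ (pos g j) ≡ suc M
    top j<n lt = ≤-antisym (≤-pred (subst (val ζ (pos g _) <_) ζ≡ (val< ζ (pos< g j<n))))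
                           (subst (_< val ζ (pos g _)) vi≡M (preserves-< g i<n j<n lt))

  TwoBelow-avoids-secondMin : ∀ {i} → i < size π → val ζ (pos g i) ≡ 1 → ¬ TwoBelow π i
  TwoBelow-avoids-secondMin {i} i<n vi≡1 (j , j′ , j<n , j′<n , j≢j′ , j<i , j′<i) =
    j≢j′ (pos-injective g j<n j′<n (val-injective ζ (pos< g j<n) (pos< g j′<n) (trans (bottom j<n j<i) (sym (bottom j′<n j′<i)))))
    where
    bottom : ∀ {j} → j < size π → val π j < val π i → val ζ (pos g j) ≡ 0
    bottom j<n lt = n<1⇒n≡0 (subst (val ζ (pos g _) <_) vi≡1 (preserves-< g j<n i<n lt))

  Above-avoids-max : ∀ {i M} → size ζ ≡ suc M → i < size π → val ζ (pos g i) ≡ M → ¬ Above π i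
  Above-avoids-max {i} {M} ζ≡ i<n vi≡M (j , j<n , lt) =
    <⇒≱ (subst (_< val ζ (pos g j)) vi≡M (preserves-< g i<n j<n lt))
        (≤-pred (subst (val ζ (pos g j) <_) ζ≡ (val< ζ (pos< g j<n))))

  Below-avoids-min : ∀ {i} → i < size π → val ζ (pos g i) ≡ 0 → ¬ Below π i
  Below-avoids-min {i} i<n vi≡0 (j , j<n , lt) = n≮0 (subst (val ζ (pos g j) <_) vi≡0 (preserves-< g j<n i<n lt))

-- Sum and skew decompositions

-- ω = α ⊕ β with α of size k, resp. ω = α ⊖ β.
SumSplit SkewSplit : ℕPerm → ℕ → Set
SumSplit ω k = 0 < k × k < size ω × (∀ {i i′} → i < k → k ≤ i′ → i′ < size ω → val ω i < val ω i′)
SkewSplit ω k = 0 < k × k < size ω × (∀ {i i′} → i < k → k ≤ i′ → i′ < size ω → val ω i′ < val ω i)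

NoSum NoSkew : ℕPerm → Set
NoSum ζ = ∀ k → ¬ SumSplit ζ k
NoSkew ζ = ∀ k → ¬ SkewSplit ζ k

module _ (ω : ℕPerm) {k : ℕ} (split : SumSplit ω k) where

  private
    k<n : k < size ω
    k<n = proj₁ (proj₂ split)
    sep : ∀ {i i′} → i < k → k ≤ i′ → i′ < size ω → val ω i < val ω i′
    sep = proj₂ (proj₂ split)

    right< : ∀ {t} → t < size ω ∸ k → k + t < size ω
    right< = t<n∸k⇒k+t<n (<⇒≤ k<n)

  -- Otherwise the size ω ∸ k entries to the right of the split would lie above k.
  SumSplit-low : ∀ {i} → i < k → val ω i < k
  SumSplit-low {i} i<k with <-≤-connex (val ω i) k
  ... | inj₁ lt = lt
  ... | inj₂ k≤vi = ⊥-elim (<⇒≱ (∸-monoʳ-< (n<1+n k) k<n) right-block-fits)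
    where
    above : ∀ {t} → t < size ω ∸ k → suc k ≤ val ω (k + t)
    above t<m = ≤-<-trans k≤vi (sep i<k (m≤m+n k _) (right< t<m))
    right-block-fits : size ω ∸ k ≤ size ω ∸ suc k
    right-block-fits = bounded-injective⇒≤ (λ t → val ω (k + t) ∸ suc k)
      (λ t<m → ∸-monoˡ-< (val< ω (right< t<m)) (above t<m))
      (λ t<m t′<m eq → +-cancelˡ-≡ k _ _ (val-injective ω (right< t<m) (right< t′<m) (∸-cancelʳ-≡ (above t<m) (above t′<m) eq)))

  -- Otherwise the k entries to the left of the split would lie below val ω i < k.
  SumSplit-high : ∀ {i} → k ≤ i → i < size ω → k ≤ val ω i
  SumSplit-high {i} k≤i i<n with <-≤-connex (val ω i) k
  ... | inj₂ k≤vi = k≤vi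
  ... | inj₁ vi<k = ⊥-elim (<⇒≱ vi<k (bounded-injective⇒≤ (val ω) (λ t<k → sep t<k k≤i i<n)
                                        (λ t<k t′<k → val-injective ω (<-trans t<k k<n) (<-trans t′<k k<n))))

  leftSummand : ℕPerm
  leftSummand = mkℕPerm k (val ω) SumSplit-low (λ i<k j<k → val-injective ω (<-trans i<k k<n) (<-trans j<k k<n))

  rightSummand : ℕPerm
  rightSummand = mkℕPerm (size ω ∸ k) (λ t → val ω (k + t) ∸ k) rightVal< rightVal-injective
    where
    k≤right : ∀ {t} → t < size ω ∸ k → k ≤ val ω (k + t)
    k≤right t<m = SumSplit-high (m≤m+n k _) (right< t<m)
    rightVal< : ∀ {t} → t < size ω ∸ k → val ω (k + t) ∸ k < size ω ∸ k
    rightVal< t<m = ∸-monoˡ-< (val< ω (right< t<m)) (k≤right t<m)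
    rightVal-injective : ∀ {t t′} → t < size ω ∸ k → t′ < size ω ∸ k →
                         val ω (k + t) ∸ k ≡ val ω (k + t′) ∸ k → t ≡ t′
    rightVal-injective t<m t′<m eq =
      +-cancelˡ-≡ k _ _ (val-injective ω (right< t<m) (right< t′<m) (∸-cancelʳ-≡ (k≤right t<m) (k≤right t′<m) eq))

  leftSummand-⊑ : leftSummand ⊑ ω
  leftSummand-⊑ = mk⊑ (λ i → i) (λ i<k → <-trans i<k k<n) (λ i<j _ → i<j) (λ _ _ lt → lt) (λ _ _ lt → lt)

  rightSummand-⊑ : rightSummand ⊑ ω
  rightSummand-⊑ = mk⊑ (k +_) right< (λ t<t′ _ → +-monoʳ-< k t<t′)
    (λ t<m t′<m lt → subst₂ _<_ (m∸n+n≡m (k≤right t<m)) (m∸n+n≡m (k≤right t′<m)) (+-monoˡ-< k lt))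
    (λ t<m _ lt → ∸-monoˡ-< lt (k≤right t<m))
    where
    k≤right : ∀ {t} → t < size ω ∸ k → k ≤ val ω (k + t)
    k≤right t<m = SumSplit-high (m≤m+n k _) (right< t<m)

⊕-val : ℕPerm → ℕPerm → ℕ → ℕ
⊕-val σ τ i with i <? size σ
... | yes _ = val σ i
... | no _ = size σ + val τ (i ∸ size σ)

module _ (σ τ : ℕPerm) where

  ⊕-val-left : ∀ {i} → i < size σ → ⊕-val σ τ i ≡ val σ i
  ⊕-val-left {i} i<a with i <? size σ
  ... | yes _ = refl
  ... | no i≮a = ⊥-elim (i≮a i<a)

  ⊕-val-right : ∀ {i} → size σ ≤ i → ⊕-val σ τ i ≡ size σ + val τ (i ∸ size σ)
  ⊕-val-right {i} a≤i with i <? size σ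
  ... | yes i<a = ⊥-elim (<⇒≱ i<a a≤i)
  ... | no _ = refl

  ⊕-val-left< : ∀ {i} → i < size σ → ⊕-val σ τ i < size σ
  ⊕-val-left< i<a = subst (_< size σ) (sym (⊕-val-left i<a)) (val< σ i<a)

  ⊕-val-right≥ : ∀ {i} → size σ ≤ i → size σ ≤ ⊕-val σ τ i
  ⊕-val-right≥ a≤i = subst (size σ ≤_) (sym (⊕-val-right a≤i)) (m≤m+n _ _)

  infixl 6 _⊕_
  _⊕_ : ℕPerm
  _⊕_ = mkℕPerm (size σ + size τ) (⊕-val σ τ) ⊕-val< ⊕-val-injective
    where
    a : ℕ
    a = size σ
    ⊕-val< : ∀ {i} → i < a + size τ → ⊕-val σ τ i < a + size τ
    ⊕-val< {i} i<n with <-≤-connex i a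
    ... | inj₁ i<a = <-≤-trans (⊕-val-left< i<a) (m≤m+n a _)
    ... | inj₂ a≤i = subst (_< a + size τ) (sym (⊕-val-right a≤i)) (+-monoʳ-< a (val< τ (i<a+b⇒i∸a<b a a≤i i<n)))
    ⊕-val-injective : ∀ {i j} → i < a + size τ → j < a + size τ → ⊕-val σ τ i ≡ ⊕-val σ τ j → i ≡ j
    ⊕-val-injective {i} {j} i<n j<n eq with <-≤-connex i a | <-≤-connex j a
    ... | inj₁ i<a | inj₁ j<a = val-injective σ i<a j<a (trans (sym (⊕-val-left i<a)) (trans eq (⊕-val-left j<a)))
    ... | inj₁ i<a | inj₂ a≤j = ⊥-elim (<⇒≱ (⊕-val-left< i<a) (subst (a ≤_) (sym eq) (⊕-val-right≥ a≤j)))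
    ... | inj₂ a≤i | inj₁ j<a = ⊥-elim (<⇒≱ (⊕-val-left< j<a) (subst (a ≤_) eq (⊕-val-right≥ a≤i)))
    ... | inj₂ a≤i | inj₂ a≤j = begin
      i                ≡⟨ m+[n∸m]≡n a≤i ⟨
      a + (i ∸ a)      ≡⟨ cong (a +_) (val-injective τ (i<a+b⇒i∸a<b a a≤i i<n) (i<a+b⇒i∸a<b a a≤j j<n)
                            (+-cancelˡ-≡ a _ _ (trans (sym (⊕-val-right a≤i)) (trans eq (⊕-val-right a≤j))))) ⟩
      a + (j ∸ a)      ≡⟨ m+[n∸m]≡n a≤j ⟩
      j                ∎
      where open ≡-Reasoning

module _ {α β σ τ : ℕPerm} (h₁ : α ⊑ σ) (h₂ : β ⊑ τ) where

  private
    a : ℕ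
    a = size α

    ⊕-pos : ℕ → ℕ
    ⊕-pos i with i <? a
    ... | yes _ = pos h₁ i
    ... | no _ = size σ + pos h₂ (i ∸ a)

    ⊕-pos-left : ∀ {i} → i < a → ⊕-pos i ≡ pos h₁ i
    ⊕-pos-left {i} i<a with i <? a
    ... | yes _ = refl
    ... | no i≮a = ⊥-elim (i≮a i<a)

    ⊕-pos-right : ∀ {i} → a ≤ i → ⊕-pos i ≡ size σ + pos h₂ (i ∸ a)
    ⊕-pos-right {i} a≤i with i <? a
    ... | yes i<a = ⊥-elim (<⇒≱ i<a a≤i)
    ... | no _ = refl

    right< : ∀ {i} → a ≤ i → i < size (α ⊕ β) → i ∸ a < size β
    right< = i<a+b⇒i∸a<b a

    val-left : ∀ {i} → i < a → ⊕-val σ τ (⊕-pos i) ≡ val σ (pos h₁ i)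
    val-left i<a = trans (cong (⊕-val σ τ) (⊕-pos-left i<a)) (⊕-val-left σ τ (pos< h₁ i<a))

    val-right : ∀ {i} → a ≤ i → ⊕-val σ τ (⊕-pos i) ≡ size σ + val τ (pos h₂ (i ∸ a))
    val-right a≤i = trans (cong (⊕-val σ τ) (⊕-pos-right a≤i))
                          (trans (⊕-val-right σ τ (m≤m+n (size σ) _)) (cong (λ x → size σ + val τ x) (m+n∸m≡n (size σ) _)))

    left<right : ∀ {i j} → i < a → a ≤ j → ⊕-val σ τ (⊕-pos i) < ⊕-val σ τ (⊕-pos j)
    left<right i<a a≤j = subst₂ _<_ (sym (val-left i<a)) (sym (val-right a≤j))
                                    (<-≤-trans (val< σ (pos< h₁ i<a)) (m≤m+n _ _))

  ⊕-mono-⊑ : α ⊕ β ⊑ σ ⊕ τ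
  ⊕-mono-⊑ = mk⊑ ⊕-pos ⊕-pos< ⊕-pos-mono preserves reflects
    where
    ⊕-pos< : ∀ {i} → i < size (α ⊕ β) → ⊕-pos i < size (σ ⊕ τ)
    ⊕-pos< {i} i<n with <-≤-connex i a
    ... | inj₁ i<a = subst (_< size (σ ⊕ τ)) (sym (⊕-pos-left i<a)) (<-≤-trans (pos< h₁ i<a) (m≤m+n _ _))
    ... | inj₂ a≤i = subst (_< size (σ ⊕ τ)) (sym (⊕-pos-right a≤i)) (+-monoʳ-< (size σ) (pos< h₂ (right< a≤i i<n)))
    ⊕-pos-mono : ∀ {i j} → i < j → j < size (α ⊕ β) → ⊕-pos i < ⊕-pos j
    ⊕-pos-mono {i} {j} i<j j<n with <-≤-connex i a | <-≤-connex j a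
    ... | inj₁ i<a | inj₁ j<a = subst₂ _<_ (sym (⊕-pos-left i<a)) (sym (⊕-pos-left j<a)) (pos-mono h₁ i<j j<a)
    ... | inj₁ i<a | inj₂ a≤j = subst₂ _<_ (sym (⊕-pos-left i<a)) (sym (⊕-pos-right a≤j)) (<-≤-trans (pos< h₁ i<a) (m≤m+n _ _))
    ... | inj₂ a≤i | inj₁ j<a = ⊥-elim (<⇒≱ (<-trans i<j j<a) a≤i)
    ... | inj₂ a≤i | inj₂ a≤j = subst₂ _<_ (sym (⊕-pos-right a≤i)) (sym (⊕-pos-right a≤j))
                                   (+-monoʳ-< (size σ) (pos-mono h₂ (∸-monoˡ-< i<j a≤i) (right< a≤j j<n)))
    preserves : ∀ {i j} → i < size (α ⊕ β) → j < size (α ⊕ β) →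
                ⊕-val α β i < ⊕-val α β j → ⊕-val σ τ (⊕-pos i) < ⊕-val σ τ (⊕-pos j)
    preserves {i} {j} i<n j<n lt with <-≤-connex i a | <-≤-connex j a
    ... | inj₁ i<a | inj₁ j<a = subst₂ _<_ (sym (val-left i<a)) (sym (val-left j<a))
                                  (preserves-< h₁ i<a j<a (subst₂ _<_ (⊕-val-left α β i<a) (⊕-val-left α β j<a) lt))
    ... | inj₁ i<a | inj₂ a≤j = left<right i<a a≤j
    ... | inj₂ a≤i | inj₁ j<a = ⊥-elim (<-asym lt (subst₂ _<_ (sym (⊕-val-left α β j<a)) refl
                                  (<-≤-trans (val< α j<a) (⊕-val-right≥ α β a≤i))))
    ... | inj₂ a≤i | inj₂ a≤j = subst₂ _<_ (sym (val-right a≤i)) (sym (val-right a≤j)) (+-monoʳ-< (size σ)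
                                  (preserves-< h₂ (right< a≤i i<n) (right< a≤j j<n)
                                    (+-cancelˡ-< a _ _ (subst₂ _<_ (⊕-val-right α β a≤i) (⊕-val-right α β a≤j) lt))))
    reflects : ∀ {i j} → i < size (α ⊕ β) → j < size (α ⊕ β) →
               ⊕-val σ τ (⊕-pos i) < ⊕-val σ τ (⊕-pos j) → ⊕-val α β i < ⊕-val α β j
    reflects {i} {j} i<n j<n lt with <-≤-connex i a | <-≤-connex j a
    ... | inj₁ i<a | inj₁ j<a = subst₂ _<_ (sym (⊕-val-left α β i<a)) (sym (⊕-val-left α β j<a))
                                  (reflects-< h₁ i<a j<a (subst₂ _<_ (val-left i<a) (val-left j<a) lt))
    ... | inj₁ i<a | inj₂ a≤j = <-≤-trans (⊕-val-left< α β i<a) (⊕-val-right≥ α β a≤j)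
    ... | inj₂ a≤i | inj₁ j<a = ⊥-elim (<-asym lt (left<right j<a a≤i))
    ... | inj₂ a≤i | inj₂ a≤j = subst₂ _<_ (sym (⊕-val-right α β a≤i)) (sym (⊕-val-right α β a≤j)) (+-monoʳ-< a
                                  (reflects-< h₂ (right< a≤i i<n) (right< a≤j j<n)
                                    (+-cancelˡ-< (size σ) _ _ (subst₂ _<_ (val-right a≤i) (val-right a≤j) lt))))

SumSplit⇒⊑⊕ : ∀ ω {k} (split : SumSplit ω k) → ω ⊑ leftSummand ω split ⊕ rightSummand ω split
SumSplit⇒⊑⊕ ω {k} split@(_ , k<n , _) = same-entries⇒⊑ (sym (m+[n∸m]≡n (<⇒≤ k<n))) same
  where
  same : ∀ {i} → i < size ω → val ω i ≡ ⊕-val (leftSummand ω split) (rightSummand ω split) i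
  same {i} i<n with <-≤-connex i k
  ... | inj₁ i<k = sym (⊕-val-left (leftSummand ω split) (rightSummand ω split) i<k)
  ... | inj₂ k≤i = begin
    val ω i                             ≡⟨ m∸n+n≡m (SumSplit-high ω split k≤i i<n) ⟨
    val ω i ∸ k + k                     ≡⟨ +-comm _ k ⟩
    k + (val ω i ∸ k)                   ≡⟨ cong (λ x → k + (val ω x ∸ k)) (m+[n∸m]≡n k≤i) ⟨
    k + (val ω (k + (i ∸ k)) ∸ k)       ≡⟨ ⊕-val-right (leftSummand ω split) (rightSummand ω split) k≤i ⟨
    ⊕-val (leftSummand ω split) (rightSummand ω split) i ∎
    where open ≡-Reasoning

module _ (σ τ : ℕPerm) where

  ⊑-⊕ˡ : σ ⊑ σ ⊕ τ
  ⊑-⊕ˡ = mk⊑ (λ i → i) (λ i<a → <-≤-trans i<a (m≤m+n _ _)) (λ i<j _ → i<j)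
    (λ i<a j<a → subst₂ _<_ (sym (⊕-val-left σ τ i<a)) (sym (⊕-val-left σ τ j<a)))
    (λ i<a j<a → subst₂ _<_ (⊕-val-left σ τ i<a) (⊕-val-left σ τ j<a))

  ⊕-val-shift : ∀ u → ⊕-val σ τ (size σ + u) ≡ size σ + val τ u
  ⊕-val-shift u = trans (⊕-val-right σ τ (m≤m+n _ _)) (cong (λ x → size σ + val τ x) (m+n∸m≡n (size σ) u))

  ⊑-⊕ʳ : τ ⊑ σ ⊕ τ
  ⊑-⊕ʳ = mk⊑ (size σ +_) (+-monoʳ-< (size σ)) (λ i<j _ → +-monoʳ-< (size σ) i<j)
    (λ {i} {j} _ _ lt → subst₂ _<_ (sym (⊕-val-shift i)) (sym (⊕-val-shift j)) (+-monoʳ-< (size σ) lt))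
    (λ {i} {j} _ _ lt → +-cancelˡ-< (size σ) _ _ (subst₂ _<_ (⊕-val-shift i) (⊕-val-shift j) lt))

SumSplit-restrict : ∀ {σ ζ k k′} (h : σ ⊑ ζ) → SumSplit ζ k → 0 < k′ → k′ < size σ →
                    (∀ {u} → u < k′ → pos h u < k) → (∀ {u} → k′ ≤ u → u < size σ → k ≤ pos h u) →
                    SumSplit σ k′
SumSplit-restrict h (_ , _ , sep) 0<k′ k′<n before after =
  0<k′ , k′<n , λ u<k′ k′≤u′ u′<n →
    reflects-< h (<-trans u<k′ k′<n) u′<n (sep (before u<k′) (after k′≤u′ u′<n) (pos< h u′<n))

-- Since π ends below its first entry, no embedding of π into σ ⊕ τ meets both blocks.
⊕-avoid : ∀ {π σ τ m} → size π ≡ suc m → val π m < val π 0 → ¬ π ⊑ σ → ¬ π ⊑ τ → ¬ π ⊑ σ ⊕ τ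
⊕-avoid {π} {σ} {τ} {m} π≡ last<first ¬π⊑σ ¬π⊑τ g
  with <-≤-connex (pos g m) (size σ) | <-≤-connex (pos g 0) (size σ)
... | inj₁ last-left | _ = ¬π⊑σ (mk⊑ (pos g) inside (pos-mono g)
        (λ i<n j<n lt → subst₂ _<_ (⊕-val-left σ τ (inside i<n)) (⊕-val-left σ τ (inside j<n)) (preserves-< g i<n j<n lt))
        (λ i<n j<n lt → reflects-< g i<n j<n (subst₂ _<_ (sym (⊕-val-left σ τ (inside i<n))) (sym (⊕-val-left σ τ (inside j<n))) lt)))
  where
  inside : ∀ {i} → i < size π → pos g i < size σ
  inside i<n = ≤-<-trans (proj₂ (pos-between g π≡ i<n)) last-left
... | inj₂ _ | inj₂ first-right = ¬π⊑τ (mk⊑ (λ i → pos g i ∸ size σ)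
        (λ i<n → i<a+b⇒i∸a<b (size σ) (inside i<n) (pos< g i<n))
        (λ i<j j<n → ∸-monoˡ-< (pos-mono g i<j j<n) (inside (<-trans i<j j<n)))
        (λ i<n j<n lt → +-cancelˡ-< (size σ) _ _ (subst₂ _<_ (shifted i<n) (shifted j<n) (preserves-< g i<n j<n lt)))
        (λ i<n j<n lt → reflects-< g i<n j<n (subst₂ _<_ (sym (shifted i<n)) (sym (shifted j<n)) (+-monoʳ-< (size σ) lt))))
  where
  inside : ∀ {i} → i < size π → size σ ≤ pos g i
  inside i<n = ≤-trans first-right (proj₁ (pos-between g π≡ i<n))
  shifted : ∀ {i} → i < size π → ⊕-val σ τ (pos g i) ≡ size σ + val τ (pos g i ∸ size σ)
  shifted i<n = ⊕-val-right σ τ (inside i<n)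
... | inj₂ last-right | inj₁ first-left = <-asym last<first
        (reflects-< g (subst (0 <_) (sym π≡) (s≤s z≤n)) (subst (m <_) (sym π≡) (n<1+n m))
                      (<-≤-trans (⊕-val-left< σ τ first-left) (⊕-val-right≥ σ τ last-right)))

-- Complement

∸suc< : ∀ {x m} → x < m → m ∸ suc x < m
∸suc< x<m = ∸-monoʳ-< (s≤s z≤n) x<m

∸suc-mono : ∀ {x y m} → x < y → y < m → m ∸ suc y < m ∸ suc x
∸suc-mono x<y y<m = ∸-monoʳ-< (s≤s x<y) y<m

∸suc-cancel : ∀ m {x y} → m ∸ suc y < m ∸ suc x → x < y
∸suc-cancel m lt = ≤-pred (∸-cancelʳ-< {o = m} lt)

∸suc-involutive : ∀ {x m} → x < m → m ∸ suc (m ∸ suc x) ≡ x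
∸suc-involutive {m = suc _} (s≤s x≤m) = m∸[m∸n]≡n x≤m

-- The complement ρᶜ(i) = n − 1 − ρ(i) turns sums into skew sums and vice versa.
complement : ℕPerm → ℕPerm
complement ρ = mkℕPerm (size ρ) (λ i → size ρ ∸ suc (val ρ i)) (∸suc< ∘ val< ρ)
  (λ i<n j<n eq → val-injective ρ i<n j<n (suc-injective (∸-cancelˡ-≡ (val< ρ i<n) (val< ρ j<n) eq)))

complement-⊑ : ∀ {p q} → p ⊑ q → complement p ⊑ complement q
complement-⊑ {p} {q} h = mk⊑ (pos h) (pos< h) (pos-mono h)
  (λ i<n j<n lt → ∸suc-mono (preserves-< h j<n i<n (∸suc-cancel (size p) lt)) (val< q (pos< h i<n)))
  (λ i<n j<n lt → ∸suc-mono (reflects-< h j<n i<n (∸suc-cancel (size q) lt)) (val< p i<n))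

⊑-complement² : ∀ ρ → ρ ⊑ complement (complement ρ)
⊑-complement² ρ = same-entries⇒⊑ refl (sym ∘ ∸suc-involutive ∘ val< ρ)

complement²-⊑ : ∀ ρ → complement (complement ρ) ⊑ ρ
complement²-⊑ ρ = same-entries⇒⊑ refl (∸suc-involutive ∘ val< ρ)

complement-SumSplit : ∀ ρ {k} → SumSplit (complement ρ) k → SkewSplit ρ k
complement-SumSplit ρ (0<k , k<n , sep) = 0<k , k<n , λ i<k k≤i′ i′<n → ∸suc-cancel (size ρ) (sep i<k k≤i′ i′<n)

complement-SkewSplit : ∀ ρ {k} → SkewSplit (complement ρ) k → SumSplit ρ k
complement-SkewSplit ρ (0<k , k<n , sep) = 0<k , k<n , λ i<k k≤i′ i′<n → ∸suc-cancel (size ρ) (sep i<k k≤i′ i′<n)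

SkewSplit-complement : ∀ ρ {k} → SkewSplit ρ k → SumSplit (complement ρ) k
SkewSplit-complement ρ (0<k , k<n , sep) =
  0<k , k<n , λ i<k k≤i′ i′<n → ∸suc-mono (sep i<k k≤i′ i′<n) (val< ρ (<-trans i<k k<n))

-- Indecomposable extensions by two new entries

-- Insertion at position p₁ with value v₁, then at p₂ with v₂. Entry k of ω becomes entry oldPos k of ζ,
-- of value oldVal (val ω k); the first new entry ends up at position pos₁ with value val₁.
module InsertTwo (ω : ℕPerm) (p₁ v₁ p₂ v₂ : ℕ)
                 (p₁≤ : p₁ ≤ size ω) (v₁≤ : v₁ ≤ size ω)
                 (p₂≤ : p₂ ≤ suc (size ω)) (v₂≤ : v₂ ≤ suc (size ω)) where

  ζ₁ ζ : ℕPerm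
  ζ₁ = insert ω p₁ v₁ p₁≤ v₁≤
  ζ = insert ζ₁ p₂ v₂ p₂≤ v₂≤

  oldPos oldVal : ℕ → ℕ
  oldPos k = punchIn p₂ (punchIn p₁ k)
  oldVal r = punchIn v₂ (punchIn v₁ r)

  pos₁ val₁ : ℕ
  pos₁ = punchIn p₂ p₁
  val₁ = punchIn v₂ v₁

  val-oldPos : ∀ k → val ζ (oldPos k) ≡ oldVal (val ω k)
  val-oldPos k = trans (insertVal-punchIn ζ₁ p₂ v₂ (punchIn p₁ k)) (cong (punchIn v₂) (insertVal-punchIn ω p₁ v₁ k))

  val-pos₁ : val ζ pos₁ ≡ val₁
  val-pos₁ = trans (insertVal-punchIn ζ₁ p₂ v₂ p₁) (cong (punchIn v₂) (insertVal-new ω p₁ v₁))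

  val-p₂ : val ζ p₂ ≡ v₂
  val-p₂ = insertVal-new ζ₁ p₂ v₂

  ω⊑ζ : ω ⊑ ζ
  ω⊑ζ = ⊑-trans (⊑-insert ω p₁ v₁ p₁≤ v₁≤) (⊑-insert ζ₁ p₂ v₂ p₂≤ v₂≤)

  oldPos< : ∀ {k} → k < size ω → oldPos k < size ζ
  oldPos< = pos< ω⊑ζ

  oldPos-cancel : ∀ {k k′} → oldPos k < oldPos k′ → k < k′
  oldPos-cancel = punchIn-cancel p₁ ∘ punchIn-cancel p₂

  oldVal-mono : ∀ {r r′} → r < r′ → oldVal r < oldVal r′
  oldVal-mono = punchIn-mono v₂ ∘ punchIn-mono v₁

  oldPos≢p₂ : ∀ k → oldPos k ≢ p₂
  oldPos≢p₂ k = punchIn≢ p₂ (punchIn p₁ k)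

  oldPos≢pos₁ : ∀ k → oldPos k ≢ pos₁
  oldPos≢pos₁ k = punchIn≢ p₁ k ∘ punchIn-injective p₂

  position-cases : ∀ {q} → q < size ζ → q ≡ p₂ ⊎ q ≡ pos₁ ⊎ Σ ℕ λ k → k < size ω × oldPos k ≡ q
  position-cases {q} q<n with q ≟ p₂
  ... | yes q≡p₂ = inj₁ q≡p₂
  ... | no q≢p₂ with insert-covers ζ₁ p₂ v₂ p₂≤ v₂≤ q<n q≢p₂
  ...   | k₁ , k₁<n , k₁↦q with k₁ ≟ p₁
  ...     | yes k₁≡p₁ = inj₂ (inj₁ (trans (sym k₁↦q) (cong (punchIn p₂) k₁≡p₁)))
  ...     | no k₁≢p₁ with insert-covers ω p₁ v₁ p₁≤ v₁≤ k₁<n k₁≢p₁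
  ...       | k , k<n , k↦k₁ = inj₂ (inj₂ (k , k<n , trans (cong (punchIn p₂) k↦k₁) k₁↦q))

  ⊑-factor-avoiding : ∀ {π} (g : π ⊑ ζ) → (∀ {i} → i < size π → pos g i ≢ p₂ × pos g i ≢ pos₁) → π ⊑ ω
  ⊑-factor-avoiding {π} g avoids = ⊑-factor ω⊑ζ g cover
    where
    cover : ∀ {i} → i < size π → Σ ℕ λ k → k < size ω × oldPos k ≡ pos g i
    cover i<n with position-cases (pos< g i<n)
    ... | inj₁ at-p₂ = ⊥-elim (proj₁ (avoids i<n) at-p₂)
    ... | inj₂ (inj₁ at-pos₁) = ⊥-elim (proj₂ (avoids i<n) at-pos₁)
    ... | inj₂ (inj₂ old) = old

Extension : ℕPerm → ℕPerm → Set
Extension π ω = Σ ℕPerm λ ζ → ω ⊑ ζ × ¬ π ⊑ ζ × NoSum ζ × NoSkew ζ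

-- ζ = (N−1) ω′ (2) in one-line notation, where N = size ω + 2.
module FramedBySecondExtremes (π ω : ℕPerm) (2≤M : 2 ≤ size ω) (first<last : val ω 0 < val ω (pred (size ω)))
                      (avoids : ¬ π ⊑ ω) (last : ℕ) (π≡ : size π ≡ suc last)
                      (twoAbove : TwoAbove π 0) (twoBelow : TwoBelow π last) where
  M : ℕ
  M = size ω

  0<M : 0 < M
  0<M = ≤-trans (s≤s z≤n) 2≤M

  open InsertTwo ω M 1 0 M ≤-refl 0<M z≤n (n≤1+n M)

  pos₁≡ : pos₁ ≡ suc M
  pos₁≡ = punchIn-≥ z≤n

  oldPos≡ : ∀ {k} → k < M → oldPos k ≡ suc k
  oldPos≡ k<M = trans (cong (punchIn 0) (punchIn-< k<M)) (punchIn-≥ z≤n)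

  oldVal-0 : oldVal 0 ≡ 0
  oldVal-0 = trans (cong (punchIn M) (punchIn-< {1} (s≤s z≤n))) (punchIn-< 0<M)

  oldVal-top : oldVal (pred M) ≡ suc M
  oldVal-top = trans (cong (punchIn M) (trans (punchIn-≥ (pred-mono-≤ 2≤M)) (0<⇒suc-pred≡ 0<M))) (punchIn-≥ ≤-refl)

  val-first : val ζ 0 ≡ M
  val-first = val-p₂

  val-last : val ζ (suc M) ≡ 1
  val-last = trans (cong (val ζ) (sym pos₁≡)) (trans val-pos₁ (punchIn-< 2≤M))

  -- Only π's first entry could reach the new first entry, and it has two entries above it;
  -- symmetrically at the end.
  π⋢ζ : ¬ π ⊑ ζ
  π⋢ζ g = avoids (⊑-factor-avoiding g (λ i<n → not-first i<n , not-last i<n))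
    where
    not-first : ∀ {i} → i < size π → pos g i ≢ 0
    not-first i<n at-first with pos≡0 g i<n at-first
    ... | refl = TwoAbove-avoids-secondMax g refl i<n (trans (cong (val ζ) at-first) val-first) twoAbove
    not-last : ∀ {i} → i < size π → pos g i ≢ pos₁
    not-last i<n at-last with pos≡last g refl π≡ i<n (trans at-last pos₁≡)
    ... | refl = TwoBelow-avoids-secondMin g i<n (trans (cong (val ζ) (trans at-last pos₁≡)) val-last) twoBelow

  noSum : NoSum ζ
  noSum k (0<k , k<N , sep) = <⇒≱ (subst₂ _<_ val-first val-last (sep 0<k (≤-pred k<N) ≤-refl)) 0<M

  noSkew : NoSkew ζ
  noSkew k (0<k , k<N , sep) with m≤n⇒m<n∨m≡n (≤-pred k<N)
  ... | inj₂ refl with val-surjective ω 0<M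
  ...   | t , t<M , vt≡0 = n≮0 (subst₂ _<_ val-last (trans (val-oldPos t) (trans (cong oldVal vt≡0) oldVal-0))
                                (sep (subst (_< suc M) (sym (oldPos≡ t<M)) (s≤s t<M)) ≤-refl ≤-refl))
  noSkew k (0<k , k<N , sep) | inj₁ k≤M with k ≟ 1
  ... | yes refl with val-surjective ω (0<⇒pred< 0<M)
  ...   | t , t<M , vt≡top = <-asym (subst₂ _<_ (trans (val-oldPos t) (trans (cong oldVal vt≡top) oldVal-top)) val-first
                                     (sep (s≤s z≤n) (subst (1 ≤_) (sym (oldPos≡ t<M)) (s≤s z≤n)) (oldPos< t<M)))
                                 (n<1+n M)
  noSkew k (0<k , k<N , sep) | inj₁ k≤M | no k≢1 =
    <-asym (subst₂ _<_ (val-oldPos (pred M)) (val-oldPos 0)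
             (sep (subst (_< k) (sym (oldPos≡ 0<M)) (≤∧≢⇒< 0<k (k≢1 ∘ sym)))
                  (subst (k ≤_) (sym (trans (oldPos≡ (0<⇒pred< 0<M)) (0<⇒suc-pred≡ 0<M))) (≤-pred k≤M))
                  (oldPos< (0<⇒pred< 0<M))))
           (oldVal-mono first<last)

  result : Extension π ω
  result = ζ , ω⊑ζ , π⋢ζ , noSum , noSkew

-- ζ = ω′ (1) (N−1) in one-line notation, where N = size ω + 2.
module EndingMinSecondMax (π ω : ℕPerm) (2≤M : 2 ≤ size ω) (first<last : val ω 0 < val ω (pred (size ω)))
                          (avoids : ¬ π ⊑ ω) (last : ℕ) (π≡ : size π ≡ suc last)
                          (twoAbove : TwoAbove π last) (belowEnd : ∀ {i} → i < size π → last ≤ suc i → Below π i) where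
  M : ℕ
  M = size ω

  0<M : 0 < M
  0<M = ≤-trans (s≤s z≤n) 2≤M

  open InsertTwo ω M 0 (suc M) M ≤-refl z≤n ≤-refl (n≤1+n M)

  pos₁≡ : pos₁ ≡ M
  pos₁≡ = punchIn-< (n<1+n M)

  oldPos≡ : ∀ {k} → k < M → oldPos k ≡ k
  oldPos≡ k<M = trans (cong (punchIn (suc M)) (punchIn-< k<M)) (punchIn-< (m<n⇒m<1+n k<M))

  oldVal-top : oldVal (pred M) ≡ suc M
  oldVal-top = trans (cong (punchIn M) (trans (punchIn-≥ z≤n) (0<⇒suc-pred≡ 0<M))) (punchIn-≥ ≤-refl)

  oldVal-low : ∀ {r} → suc r < M → oldVal r ≡ suc r
  oldVal-low r+1<M = trans (cong (punchIn M) (punchIn-≥ z≤n)) (punchIn-< r+1<M)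

  val-last : val ζ (suc M) ≡ M
  val-last = val-p₂

  val-penultimate : val ζ M ≡ 0
  val-penultimate = trans (cong (val ζ) (sym pos₁≡)) (trans val-pos₁ (punchIn-< 0<M))

  -- An entry of π sent to the penultimate position is among π's last two, which all have an entry below.
  π⋢ζ : ¬ π ⊑ ζ
  π⋢ζ g = avoids (⊑-factor-avoiding g (λ i<n → not-last i<n , not-penultimate i<n))
    where
    not-last : ∀ {i} → i < size π → pos g i ≢ suc M
    not-last i<n at-last with pos≡last g refl π≡ i<n at-last
    ... | refl = TwoAbove-avoids-secondMax g refl i<n (trans (cong (val ζ) at-last) val-last) twoAbove
    not-penultimate : ∀ {i} → i < size π → pos g i ≢ pos₁
    not-penultimate {i} i<n at-pen with <-≤-connex (suc (suc i)) (size π)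
    ... | inj₁ i+2<n = <⇒≱ (pos< g i+2<n) (subst (λ x → suc (suc x) ≤ pos g (suc (suc i))) (trans at-pen pos₁≡)
            (≤-trans (s≤s (pos-mono g (n<1+n i) (<-trans (n<1+n (suc i)) i+2<n))) (pos-mono g (n<1+n (suc i)) i+2<n)))
    ... | inj₂ n≤i+2 = Below-avoids-min g i<n (trans (cong (val ζ) (trans at-pen pos₁≡)) val-penultimate)
                                            (belowEnd i<n (≤-pred (subst (_≤ suc (suc i)) π≡ n≤i+2)))

  noSum : NoSum ζ
  noSum k (0<k , k<N , sep) with m≤n⇒m<n∨m≡n (≤-pred k<N)
  ... | inj₁ k≤M = n≮0 (subst (val ζ (oldPos 0) <_) val-penultimate
                          (sep (subst (_< k) (sym (oldPos≡ 0<M)) 0<k) (≤-pred k≤M) (s≤s (n≤1+n M))))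
  ... | inj₂ refl with val-surjective ω (0<⇒pred< 0<M)
  ...   | t , t<M , vt≡top = <-asym (subst₂ _<_ (trans (val-oldPos t) (trans (cong oldVal vt≡top) oldVal-top)) val-last
                                     (sep (subst (_< suc M) (sym (oldPos≡ t<M)) (m<n⇒m<1+n t<M)) ≤-refl ≤-refl))
                                 (n<1+n M)

  noSkew : NoSkew ζ
  noSkew k (0<k , k<N , sep) with <-≤-connex k M
  ... | inj₁ k<M = <-asym (subst₂ _<_ (val-oldPos (pred M)) (val-oldPos 0)
                            (sep (subst (_< k) (sym (oldPos≡ 0<M)) 0<k)
                                 (subst (k ≤_) (sym (oldPos≡ (0<⇒pred< 0<M))) (pred-mono-≤ k<M))
                                 (oldPos< (0<⇒pred< 0<M))))
                          (oldVal-mono first<last)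
  ... | inj₂ _ = <⇒≱ (subst₂ _<_ val-last (trans (val-oldPos 0) (oldVal-low first+1<M))
                          (sep (subst (_< k) (sym (oldPos≡ 0<M)) 0<k) (≤-pred k<N) ≤-refl))
                       (<⇒≤ first+1<M)
    where
    first+1<M : suc (val ω 0) < M
    first+1<M = <-≤-trans (s≤s first<last) (val< ω (0<⇒pred< 0<M))

  result : Extension π ω
  result = ζ , ω⊑ζ , π⋢ζ , noSum , noSkew

-- ζ = (2) (N) ω′ in one-line notation, where N = size ω + 2.
module StartingSecondMinMax (π ω : ℕPerm) (2≤M : 2 ≤ size ω) (first<last : val ω 0 < val ω (pred (size ω)))
                            (avoids : ¬ π ⊑ ω) (twoBelow : TwoBelow π 0)
                            (aboveStart : ∀ {i} → i < size π → i ≤ 1 → Above π i) where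
  M : ℕ
  M = size ω

  0<M : 0 < M
  0<M = ≤-trans (s≤s z≤n) 2≤M

  open InsertTwo ω 0 1 1 (suc M) z≤n 0<M (s≤s z≤n) ≤-refl

  pos₁≡ : pos₁ ≡ 0
  pos₁≡ = punchIn-< {1} (s≤s z≤n)

  oldPos≡ : ∀ k → oldPos k ≡ suc (suc k)
  oldPos≡ k = trans (cong (punchIn 1) (punchIn-≥ z≤n)) (punchIn-≥ (s≤s z≤n))

  oldPos-last≡ : oldPos (pred M) ≡ suc M
  oldPos-last≡ = trans (oldPos≡ (pred M)) (cong suc (0<⇒suc-pred≡ 0<M))

  oldVal-0 : oldVal 0 ≡ 0
  oldVal-0 = trans (cong (punchIn (suc M)) (punchIn-< {1} (s≤s z≤n))) (punchIn-< {suc M} (s≤s z≤n))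

  oldVal<max : ∀ {r} → r < M → oldVal r < suc M
  oldVal<max {r} r<M = subst (_< suc M) (sym (punchIn-< r′<M+1)) r′<M+1
    where
    r′<M+1 : punchIn 1 r < suc M
    r′<M+1 = punchIn-<suc 1 r<M

  val-first : val ζ 0 ≡ 1
  val-first = trans (cong (val ζ) (sym pos₁≡)) (trans val-pos₁ (punchIn-< (s≤s 0<M)))

  val-second : val ζ 1 ≡ suc M
  val-second = val-p₂

  π⋢ζ : ¬ π ⊑ ζ
  π⋢ζ g = avoids (⊑-factor-avoiding g (λ i<n → not-second i<n , not-first i<n))
    where
    not-second : ∀ {i} → i < size π → pos g i ≢ 1
    not-second {i} i<n at-second = Above-avoids-max g refl i<n (trans (cong (val ζ) at-second) val-second)
                                     (aboveStart i<n (subst (i ≤_) at-second (pos-≥ g i<n)))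
    not-first : ∀ {i} → i < size π → pos g i ≢ pos₁
    not-first i<n at-first with pos≡0 g i<n (trans at-first pos₁≡)
    ... | refl = TwoBelow-avoids-secondMin g i<n (trans (cong (val ζ) (trans at-first pos₁≡)) val-first) twoBelow

  noSum : NoSum ζ
  noSum k (0<k , k<N , sep) with k ≟ 1
  ... | yes refl with val-surjective ω 0<M
  ...   | t , t<M , vt≡0 = n≮0 (subst₂ _<_ val-first (trans (val-oldPos t) (trans (cong oldVal vt≡0) oldVal-0))
                                (sep (s≤s z≤n) (subst (1 ≤_) (sym (oldPos≡ t)) (s≤s z≤n)) (oldPos< t<M)))
  noSum k (0<k , k<N , sep) | no k≢1 =
    <-asym (subst₂ _<_ val-second (val-oldPos (pred M))
             (sep (≤∧≢⇒< 0<k (k≢1 ∘ sym)) (subst (k ≤_) (sym oldPos-last≡) (≤-pred k<N)) (oldPos< (0<⇒pred< 0<M))))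
           (oldVal<max (val< ω (0<⇒pred< 0<M)))

  noSkew : NoSkew ζ
  noSkew k (0<k , k<N , sep) with k ≟ 1
  ... | yes refl = <⇒≱ (subst₂ _<_ val-second val-first (sep (s≤s z≤n) ≤-refl (s≤s (s≤s z≤n)))) (s≤s z≤n)
  ... | no _ = <⇒≱ (subst₂ _<_ (val-oldPos (pred M)) val-first
                       (sep 0<k (subst (k ≤_) (sym oldPos-last≡) (≤-pred k<N)) (oldPos< (0<⇒pred< 0<M))))
                     (≤-trans (s≤s z≤n) (oldVal-mono first<last))

  result : Extension π ω
  result = ζ , ω⊑ζ , π⋢ζ , noSum , noSkew

-- For ω = α ⊕ β with α of size j: ζ = α′ (N) (1) β′ in one-line notation, where N = size ω + 2.
module MaxMinAtSplit (π ω : ℕPerm) {j : ℕ} (split : SumSplit ω j)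
                     (avoids : ¬ π ⊑ ω) (last : ℕ) (π≡ : size π ≡ suc last) (last<first : val π last < val π 0)
                     (aboveFirst : Above π 0) (belowLast : Below π last) where
  M : ℕ
  M = size ω

  0<j : 0 < j
  0<j = proj₁ split

  j<M : j < M
  j<M = proj₁ (proj₂ split)

  sep : ∀ {i i′} → i < j → j ≤ i′ → i′ < M → val ω i < val ω i′
  sep = proj₂ (proj₂ split)

  open InsertTwo ω j M (suc j) 0 (<⇒≤ j<M) ≤-refl (s≤s (<⇒≤ j<M)) z≤n

  0<M : 0 < M
  0<M = <-trans 0<j j<M

  pos₁≡ : pos₁ ≡ j
  pos₁≡ = punchIn-< (n<1+n j)

  oldPos-left : ∀ {k} → k < j → oldPos k ≡ k
  oldPos-left k<j = trans (cong (punchIn (suc j)) (punchIn-< k<j)) (punchIn-< (m<n⇒m<1+n k<j))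

  oldPos-right : ∀ {k} → j ≤ k → oldPos k ≡ suc (suc k)
  oldPos-right j≤k = trans (cong (punchIn (suc j)) (punchIn-≥ j≤k)) (punchIn-≥ (s≤s j≤k))

  oldVal≡ : ∀ {r} → r < M → oldVal r ≡ suc r
  oldVal≡ r<M = trans (cong (punchIn 0) (punchIn-< r<M)) (punchIn-≥ z≤n)

  val-max : val ζ j ≡ suc M
  val-max = trans (cong (val ζ) (sym pos₁≡)) (trans val-pos₁ (punchIn-≥ z≤n))

  val-min : val ζ (suc j) ≡ 0
  val-min = val-p₂

  ω-last<M : pred M < M
  ω-last<M = 0<⇒pred< 0<M

  j≤ω-last : j ≤ pred M
  j≤ω-last = pred-mono-≤ j<M

  oldPos-last≡ : oldPos (pred M) ≡ suc M
  oldPos-last≡ = trans (oldPos-right j≤ω-last) (cong suc (0<⇒suc-pred≡ 0<M))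

  first<n : 0 < size π
  first<n = subst (0 <_) (sym π≡) (s≤s z≤n)

  last<n : last < size π
  last<n = subst (last <_) (sym π≡) (n<1+n last)

  old-entry : (g : π ⊑ ζ) → ∀ {i} → i < size π → Above π i → Below π i → Σ ℕ λ k → k < M × oldPos k ≡ pos g i
  old-entry g i<n above below with position-cases (pos< g i<n)
  ... | inj₁ at-min = ⊥-elim (Below-avoids-min g i<n (trans (cong (val ζ) at-min) val-min) below)
  ... | inj₂ (inj₁ at-max) = ⊥-elim (Above-avoids-max g refl i<n (trans (cong (val ζ) (trans at-max pos₁≡)) val-max) above)
  ... | inj₂ (inj₂ old) = old

  -- π's first and last entries avoid the new extremes. If they land on the same side of the split,
  -- all of π does; they cannot straddle it as π ends below its start.
  π⋢ζ : ¬ π ⊑ ζ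
  π⋢ζ g with old-entry g first<n aboveFirst (last , last<n , last<first) | old-entry g last<n (0 , first<n , last<first) belowLast
  ... | k₀ , _ , k₀↦first | k₁ , k₁<M , k₁↦last = avoids (⊑-factor-avoiding g same-side)
    where
    same-side : ∀ {i} → i < size π → pos g i ≢ suc j × pos g i ≢ pos₁
    same-side i<n with pos-between g π≡ i<n | <-≤-connex k₁ j | <-≤-connex k₀ j
    ... | _ , ≤last | inj₁ k₁<j | _ =
          (λ at → <⇒≱ (<-trans k₁<j (n<1+n j)) (subst₂ _≤_ at (trans (sym k₁↦last) (oldPos-left k₁<j)) ≤last))
        , (λ at → <⇒≱ k₁<j (subst₂ _≤_ (trans at pos₁≡) (trans (sym k₁↦last) (oldPos-left k₁<j)) ≤last))
    ... | first≤ , _ | inj₂ _ | inj₂ j≤k₀ =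
          (λ at → <⇒≱ (s≤s (s≤s j≤k₀)) (subst₂ _≤_ (trans (sym k₀↦first) (oldPos-right j≤k₀)) at first≤))
        , (λ at → <⇒≱ (s≤s (≤-trans j≤k₀ (n≤1+n k₀)))
                      (subst₂ _≤_ (trans (sym k₀↦first) (oldPos-right j≤k₀)) (trans at pos₁≡) first≤))
    ... | _ | inj₂ j≤k₁ | inj₁ k₀<j = ⊥-elim (<-asym last<first (reflects-< g first<n last<n
            (subst₂ _<_ (trans (sym (val-oldPos k₀)) (cong (val ζ) k₀↦first))
                        (trans (sym (val-oldPos k₁)) (cong (val ζ) k₁↦last))
                        (oldVal-mono (sep k₀<j j≤k₁ k₁<M)))))

  noSum : NoSum ζ
  noSum k (0<k , k<N , sep′) with <-≤-connex j k
  ... | inj₂ k≤j = n≮0 (subst (val ζ (oldPos 0) <_) val-min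
                         (sep′ (subst (_< k) (sym (oldPos-left 0<j)) 0<k) (≤-trans k≤j (n≤1+n j)) (s≤s (s≤s (<⇒≤ j<M)))))
  ... | inj₁ j<k = <⇒≱ (subst₂ _<_ val-max (trans (val-oldPos (pred M)) (oldVal≡ (val< ω ω-last<M)))
                         (sep′ j<k (subst (k ≤_) (sym oldPos-last≡) (≤-pred k<N)) (oldPos< ω-last<M)))
                       (s≤s (<⇒≤ (val< ω ω-last<M)))

  noSkew : NoSkew ζ
  noSkew k (0<k , k<N , sep′) with <-≤-connex (suc j) k
  ... | inj₂ k≤j+1 = <-asym (subst₂ _<_ (val-oldPos (pred M)) (val-oldPos 0)
                              (sep′ (subst (_< k) (sym (oldPos-left 0<j)) 0<k)
                                    (subst (k ≤_) (sym oldPos-last≡) (≤-trans k≤j+1 (s≤s (<⇒≤ j<M))))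
                                    (oldPos< ω-last<M)))
                            (oldVal-mono (sep 0<j j≤ω-last ω-last<M))
  ... | inj₁ j+1<k = n≮0 (subst (val ζ (oldPos (pred M)) <_) val-min
                           (sep′ j+1<k (subst (k ≤_) (sym oldPos-last≡) (≤-pred k<N)) (oldPos< ω-last<M)))

  result : Extension π ω
  result = ζ , ω⊑ζ , π⋢ζ , noSum , noSkew

-- For σ, τ of sizes a, b: ζ = (2) σ₀′ ⋯ σₐ₋₂′ (a+3) σₐ₋₁′ τ′ in one-line notation, i.e. σ ⊕ τ with a new first
-- entry x just above its minimum and, just before the last entry of σ, a new entry y just above the minimum of τ.
module MaxFirstOverSum (π σ τ : ℕPerm) (0<a : 0 < size σ) (0<b : 0 < size τ)
                       (σ-noSum : NoSum σ) (τ-noSum : NoSum τ) (σ-avoids : ¬ π ⊑ σ) (τ-avoids : ¬ π ⊑ τ)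
                       (last : ℕ) (π≡ : size π ≡ suc last) (last<first : val π last < val π 0)
                       (first-max : ∀ {i} → i < size π → val π i ≤ val π 0)
                       (long-or-321 : 4 ≤ size π ⊎ (size π ≡ 3 × val π 2 < val π 1)) where
  a b m : ℕ
  a = size σ
  b = size τ
  m = a + b

  ρ : ℕPerm
  ρ = σ ⊕ τ

  a<m : a < m
  a<m = subst (_≤ a + b) (+-comm a 1) (+-monoʳ-≤ a 0<b)

  0<m : 0 < m
  0<m = ≤-<-trans z≤n a<m

  open InsertTwo ρ 0 1 a (suc (suc a)) z≤n 0<m (≤-trans (<⇒≤ a<m) (n≤1+n m)) (s≤s a<m)

  pos₁≡ : pos₁ ≡ 0
  pos₁≡ = punchIn-< 0<a

  oldPos-σ : ∀ {k} → suc k < a → oldPos k ≡ suc k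
  oldPos-σ k+1<a = trans (cong (punchIn a) (punchIn-≥ z≤n)) (punchIn-< k+1<a)

  oldPos-after : ∀ {k} → a ≤ suc k → oldPos k ≡ suc (suc k)
  oldPos-after a≤k+1 = trans (cong (punchIn a) (punchIn-≥ z≤n)) (punchIn-≥ a≤k+1)

  oldPos≥ : ∀ k → suc k ≤ oldPos k
  oldPos≥ k with <-≤-connex (suc k) a
  ... | inj₁ k+1<a = ≤-reflexive (sym (oldPos-σ k+1<a))
  ... | inj₂ a≤k+1 = subst (suc k ≤_) (sym (oldPos-after a≤k+1)) (n≤1+n (suc k))

  ρ-last<m : pred m < m
  ρ-last<m = 0<⇒pred< 0<m

  a≤ρ-last : a ≤ pred m
  a≤ρ-last = pred-mono-≤ a<m

  oldPos-last≡ : oldPos (pred m) ≡ suc m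
  oldPos-last≡ = trans (oldPos-after (≤-trans a≤ρ-last (n≤1+n _))) (cong suc (0<⇒suc-pred≡ 0<m))

  oldVal-0 : oldVal 0 ≡ 0
  oldVal-0 = trans (cong (punchIn (suc (suc a))) (punchIn-< {1} (s≤s z≤n))) (punchIn-< {suc (suc a)} (s≤s z≤n))

  oldVal-mid : ∀ {r} → 0 < r → r ≤ a → oldVal r ≡ suc r
  oldVal-mid 0<r r≤a = trans (cong (punchIn (suc (suc a))) (punchIn-≥ 0<r)) (punchIn-< (s≤s (s≤s r≤a)))

  oldVal-high : ∀ {r} → a < r → oldVal r ≡ suc (suc r)
  oldVal-high a<r = trans (cong (punchIn (suc (suc a))) (punchIn-≥ (≤-trans (s≤s z≤n) a<r))) (punchIn-≥ (s≤s a<r))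

  oldVal≥ : ∀ {r} → 0 < r → suc r ≤ oldVal r
  oldVal≥ {r} 0<r with <-≤-connex a r
  ... | inj₁ a<r = subst (suc r ≤_) (sym (oldVal-high a<r)) (n≤1+n (suc r))
  ... | inj₂ r≤a = ≤-reflexive (sym (oldVal-mid 0<r r≤a))

  oldVal<val-y⇒≤a : ∀ {r} → oldVal r < suc (suc a) → r ≤ a
  oldVal<val-y⇒≤a {r} lt with <-≤-connex a r
  ... | inj₂ r≤a = r≤a
  ... | inj₁ a<r = ⊥-elim (<⇒≱ lt (subst (suc (suc a) ≤_) (sym (oldVal-high a<r)) (s≤s (s≤s (<⇒≤ a<r)))))

  oldVal-σ≤a : ∀ {r} → r < a → oldVal r ≤ a
  oldVal-σ≤a {zero} _ = subst (_≤ a) (sym oldVal-0) z≤n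
  oldVal-σ≤a {suc r} r<a = subst (_≤ a) (sym (oldVal-mid (s≤s z≤n) (<⇒≤ r<a))) r<a

  val-x : val ζ 0 ≡ 1
  val-x = trans (cong (val ζ) (sym pos₁≡)) (trans val-pos₁ (punchIn-< {suc (suc a)} (s≤s (s≤s z≤n))))

  val-y : val ζ a ≡ suc (suc a)
  val-y = val-p₂

  ρ≡a⇒a≤ : ∀ {k} → val ρ k ≡ a → a ≤ k
  ρ≡a⇒a≤ {k} eq with <-≤-connex k a
  ... | inj₂ a≤k = a≤k
  ... | inj₁ k<a = ⊥-elim (<-irrefl eq (⊕-val-left< σ τ k<a))

  σ-last<a : pred a < a
  σ-last<a = 0<⇒pred< 0<a

  first<n : 0 < size π
  first<n = subst (0 <_) (sym π≡) (s≤s z≤n)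

  3≤n : 3 ≤ size π
  3≤n = [ ≤-trans (n≤1+n 3) , ≤-reflexive ∘ sym ∘ proj₁ ] long-or-321

  1<n : 1 < size π
  1<n = ≤-trans (s≤s (s≤s z≤n)) 3≤n

  below-first : ∀ {i} → i < size π → 0 < i → val π i < val π 0
  below-first i<n 0<i = ≤∧≢⇒< (first-max i<n) (λ eq → <⇒≢ 0<i (sym (val-injective π i<n first<n eq)))

  -- If π's first entry sits on y, the later entries of π lie after and below y, so on the last entry
  -- of σ or on the smallest entry of τ, in this order; this leaves no room for π.
  module FirstOnY (g : π ⊑ ζ) (first-on-y : pos g 0 ≡ a) where

    SigmaLastOrTauMin : ℕ → Set
    SigmaLastOrTauMin k = k ≡ pred a ⊎ val ρ k ≡ a

    landing : ∀ {i} → i < size π → 0 < i → Σ ℕ λ k → k < m × oldPos k ≡ pos g i × SigmaLastOrTauMin k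
    landing {i} i<n 0<i with position-cases (pos< g i<n)
    ... | inj₁ on-y = ⊥-elim (<⇒≢ (pos-mono g 0<i i<n) (trans first-on-y (sym on-y)))
    ... | inj₂ (inj₁ on-x) = ⊥-elim (n≮0 (subst (pos g 0 <_) (trans on-x pos₁≡) (pos-mono g 0<i i<n)))
    ... | inj₂ (inj₂ (k , k<m , k↦i)) = k , k<m , k↦i , class
      where
      below-y : oldVal (val ρ k) < suc (suc a)
      below-y = subst₂ _<_ (trans (cong (val ζ) (sym k↦i)) (val-oldPos k)) (trans (cong (val ζ) first-on-y) val-y)
                           (preserves-< g i<n first<n (below-first i<n 0<i))
      after-y : a < oldPos k
      after-y = subst₂ _<_ first-on-y (sym k↦i) (pos-mono g 0<i i<n)
      class : SigmaLastOrTauMin k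
      class with <-≤-connex (suc k) a | <-≤-connex k a
      ... | inj₁ k+1<a | _ = ⊥-elim (<-asym after-y (subst (_< a) (sym (oldPos-σ k+1<a)) k+1<a))
      ... | inj₂ a≤k+1 | inj₁ k<a = inj₁ (≤-antisym (pred-mono-≤ k<a) (pred-mono-≤ a≤k+1))
      ... | inj₂ _ | inj₂ a≤k = inj₂ (≤-antisym (oldVal<val-y⇒≤a below-y) (⊕-val-right≥ σ τ a≤k))

    ordered : ∀ {i j kᵢ kⱼ} → i < j → j < size π → kᵢ < m → kⱼ < m → oldPos kᵢ ≡ pos g i → oldPos kⱼ ≡ pos g j →
              SigmaLastOrTauMin kᵢ → SigmaLastOrTauMin kⱼ → kᵢ ≡ pred a × val ρ kⱼ ≡ a
    ordered {kᵢ = kᵢ} {kⱼ} i<j j<n kᵢ<m kⱼ<m kᵢ↦i kⱼ↦j = by-class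
      where
      kᵢ<kⱼ : kᵢ < kⱼ
      kᵢ<kⱼ = oldPos-cancel (subst₂ _<_ (sym kᵢ↦i) (sym kⱼ↦j) (pos-mono g i<j j<n))
      by-class : SigmaLastOrTauMin kᵢ → SigmaLastOrTauMin kⱼ → kᵢ ≡ pred a × val ρ kⱼ ≡ a
      by-class (inj₁ kᵢ≡) (inj₂ kⱼ↦a) = kᵢ≡ , kⱼ↦a
      by-class (inj₁ kᵢ≡) (inj₁ kⱼ≡) = ⊥-elim (<-irrefl (trans kᵢ≡ (sym kⱼ≡)) kᵢ<kⱼ)
      by-class (inj₂ kᵢ↦a) (inj₂ kⱼ↦a) = ⊥-elim (<-irrefl (val-injective ρ kᵢ<m kⱼ<m (trans kᵢ↦a (sym kⱼ↦a))) kᵢ<kⱼ)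
      by-class (inj₂ kᵢ↦a) (inj₁ kⱼ≡) =
        ⊥-elim (<⇒≱ (subst (kᵢ <_) kⱼ≡ kᵢ<kⱼ) (≤-trans pred[n]≤n (ρ≡a⇒a≤ kᵢ↦a)))

    val-σ-last<a : ∀ {k} → k ≡ pred a → val ρ k < a
    val-σ-last<a refl = ⊕-val-left< σ τ σ-last<a

    impossible : ⊥
    impossible with landing 1<n (s≤s z≤n) | landing 3≤n (s≤s z≤n)
    ... | k₁ , k₁<m , k₁↦1 , c₁ | k₂ , k₂<m , k₂↦2 , c₂ =
      by-shape long-or-321 (ordered (n<1+n 1) 3≤n k₁<m k₂<m k₁↦1 k₂↦2 c₁ c₂)
      where
      by-shape : 4 ≤ size π ⊎ (size π ≡ 3 × val π 2 < val π 1) → k₁ ≡ pred a × val ρ k₂ ≡ a → ⊥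
      by-shape (inj₂ (_ , π₂<π₁)) (k₁≡ , k₂↦a) = <-asym π₂<π₁ (reflects-< g 1<n 3≤n
        (subst₂ _<_ (trans (sym (val-oldPos k₁)) (cong (val ζ) k₁↦1)) (trans (sym (val-oldPos k₂)) (cong (val ζ) k₂↦2))
                    (oldVal-mono (subst (val ρ k₁ <_) (sym k₂↦a) (val-σ-last<a k₁≡)))))
      by-shape (inj₁ 4≤n) (_ , k₂↦a) with landing 4≤n (s≤s z≤n)
      ... | k₃ , k₃<m , k₃↦3 , c₃ =
        <-irrefl k₂↦a (val-σ-last<a (proj₁ (ordered (n<1+n 2) 4≤n k₂<m k₃<m k₂↦2 k₃↦3 c₂ c₃)))

  -- Once π's first entry is an old one, x lies before it and y either above it or before it, so π embeds in σ ⊕ τ.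
  π⋢ζ : ¬ π ⊑ ζ
  π⋢ζ g with position-cases (pos< g first<n)
  ... | inj₁ first-on-y = FirstOnY.impossible g first-on-y
  ... | inj₂ (inj₁ first-on-x) = TwoBelow-avoids-secondMin g first<n (trans (cong (val ζ) (trans first-on-x pos₁≡)) val-x)
                                   (1 , 2 , 1<n , 3≤n , (λ ()) , below-first 1<n (s≤s z≤n) , below-first 3≤n (s≤s z≤n))
  ... | inj₂ (inj₂ (k₀ , _ , k₀↦first)) = ⊕-avoid π≡ last<first σ-avoids τ-avoids (⊑-factor-avoiding g not-new)
    where
    not-new : ∀ {i} → i < size π → pos g i ≢ a × pos g i ≢ pos₁
    not-new {zero} _ = oldPos≢p₂ k₀ ∘ trans k₀↦first , oldPos≢pos₁ k₀ ∘ trans k₀↦first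
    not-new {suc i} i<n = not-y , not-x
      where
      after-first : pos g 0 < pos g (suc i)
      after-first = pos-mono g (s≤s z≤n) i<n
      not-x : pos g (suc i) ≢ pos₁
      not-x on-x = n≮0 (subst (pos g 0 <_) (trans on-x pos₁≡) after-first)
      not-y : pos g (suc i) ≢ a
      not-y on-y with <-≤-connex k₀ a
      ... | inj₁ k₀<a = <⇒≱ (subst₂ _<_ (trans (cong (val ζ) on-y) val-y) (trans (cong (val ζ) (sym k₀↦first)) (val-oldPos k₀))
                                       (preserves-< g i<n first<n (below-first i<n (s≤s z≤n))))
                             (≤-trans (oldVal-σ≤a (⊕-val-left< σ τ k₀<a)) (≤-trans (n≤1+n a) (n≤1+n (suc a))))
      ... | inj₂ a≤k₀ = <⇒≱ (subst₂ _<_ (trans (sym k₀↦first) (oldPos-after (≤-trans a≤k₀ (n≤1+n k₀)))) on-y after-first)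
                             (≤-trans a≤k₀ (≤-trans (n≤1+n k₀) (n≤1+n (suc k₀))))

  noSkew : NoSkew ζ
  noSkew k (0<k , k<N , sep) =
    <⇒≱ (subst₂ _<_ (val-oldPos (pred m)) val-x
          (sep 0<k (subst (k ≤_) (sym oldPos-last≡) (≤-pred k<N)) (oldPos< ρ-last<m)))
        (≤-trans (s≤s z≤n) (oldVal≥ (≤-trans 0<a (⊕-val-right≥ σ τ a≤ρ-last))))

  -- A sum split of ζ left of y restricts to σ; one right of y to τ, unless the smallest entry of τ lies right of it.
  noSum : NoSum ζ
  noSum k split@(0<k , k<N , sep) with k ≟ 1
  ... | yes refl with val-surjective ρ 0<m
  ...   | t , t<m , vt≡0 = n≮0 (subst₂ _<_ val-x (trans (val-oldPos t) (trans (cong oldVal vt≡0) oldVal-0))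
                                (sep (s≤s z≤n) (≤-trans (s≤s z≤n) (oldPos≥ t)) (oldPos< t<m)))
  noSum k split@(0<k , k<N , sep) | no k≢1 with <-≤-connex a k
  ... | inj₂ k≤a = σ-noSum (pred k) (SumSplit-restrict (⊑-trans (⊑-⊕ˡ σ τ) ω⊑ζ) split
                     (pred-mono-≤ (≤∧≢⇒< 0<k (k≢1 ∘ sym))) (<-≤-trans (0<⇒pred< 0<k) k≤a) before after)
    where
    before : ∀ {u} → u < pred k → oldPos u < k
    before {u} u<k-1 = subst (_< k) (sym (oldPos-σ (<-≤-trans u+1<k k≤a))) u+1<k
      where
      u+1<k : suc u < k
      u+1<k = <-≤-trans (s≤s u<k-1) (≤-reflexive (0<⇒suc-pred≡ 0<k))
    after : ∀ {u} → pred k ≤ u → u < a → k ≤ oldPos u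
    after {u} k-1≤u _ = ≤-trans (subst (_≤ suc u) (0<⇒suc-pred≡ 0<k) (s≤s k-1≤u)) (oldPos≥ u)
  ... | inj₁ a<k with val-surjective ρ a<m
  ...   | t , t<m , vt≡a with <-≤-connex (oldPos t) k
  ...     | inj₂ k≤oldPos-t = <-asym (subst₂ _<_ val-y (trans (val-oldPos t) (trans (cong oldVal vt≡a) (oldVal-mid 0<a ≤-refl)))
                                       (sep a<k k≤oldPos-t (oldPos< t<m)))
                                     (n<1+n (suc a))
  ...     | inj₁ oldPos-t<k = τ-noSum k′ (SumSplit-restrict (⊑-trans (⊑-⊕ʳ σ τ) ω⊑ζ) split 0<k′ k′<b before after)
    where
    c k′ : ℕ
    c = suc (suc a)
    k′ = k ∸ c
    oldPos-τ : ∀ u → oldPos (a + u) ≡ c + u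
    oldPos-τ u = oldPos-after (≤-trans (m≤m+n a u) (n≤1+n _))
    c<k : c < k
    c<k = ≤-<-trans (subst (c ≤_) (sym (oldPos-after (≤-trans (ρ≡a⇒a≤ vt≡a) (n≤1+n t)))) (s≤s (s≤s (ρ≡a⇒a≤ vt≡a))))
                    oldPos-t<k
    k≡ : c + k′ ≡ k
    k≡ = m+[n∸m]≡n (<⇒≤ c<k)
    0<k′ : 0 < k′
    0<k′ = +-cancelˡ-< c 0 k′ (subst₂ _<_ (sym (+-identityʳ c)) (sym k≡) c<k)
    k′<b : k′ < b
    k′<b = +-cancelˡ-< c k′ b (subst (_< c + b) (sym k≡) k<N)
    before : ∀ {u} → u < k′ → oldPos (a + u) < k
    before {u} u<k′ = subst₂ _<_ (sym (oldPos-τ u)) k≡ (+-monoʳ-< c u<k′)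
    after : ∀ {u} → k′ ≤ u → u < b → k ≤ oldPos (a + u)
    after {u} k′≤u _ = subst₂ _≤_ k≡ (sym (oldPos-τ u)) (+-monoʳ-≤ c k′≤u)

  result : Extension π (σ ⊕ τ)
  result = ζ , ω⊑ζ , π⋢ζ , noSum , noSkew

-- For σ, τ of sizes a, b: ζ is σ ⊕ τ with a new entry y of value a (in one-line notation), just below the
-- maximum of σ, right after the first entry of τ, and a new last entry x of value N − 1, where N = a + b + 2.
module MinLastOverSum (π σ τ : ℕPerm) (0<a : 0 < size σ) (0<b : 0 < size τ)
                      (σ-noSum : NoSum σ) (τ-noSum : NoSum τ) (σ-avoids : ¬ π ⊑ σ) (τ-avoids : ¬ π ⊑ τ)
                      (last : ℕ) (π≡ : size π ≡ suc last) (last<first : val π last < val π 0)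
                      (last-min : ∀ {i} → i < size π → val π last ≤ val π i)
                      (long-or-321 : 4 ≤ size π ⊎ (size π ≡ 3 × val π 1 < val π 0)) where
  a b m : ℕ
  a = size σ
  b = size τ
  m = a + b

  ρ : ℕPerm
  ρ = σ ⊕ τ

  a<m : a < m
  a<m = subst (_≤ a + b) (+-comm a 1) (+-monoʳ-≤ a 0<b)

  0<m : 0 < m
  0<m = ≤-<-trans z≤n a<m

  σ-max<a : pred a < a
  σ-max<a = 0<⇒pred< 0<a

  σ-max<m : pred a < m
  σ-max<m = <-trans σ-max<a a<m

  open InsertTwo ρ (suc a) (pred a) (suc m) m a<m (<⇒≤ σ-max<m) ≤-refl (n≤1+n m)

  pos₁≡ : pos₁ ≡ suc a
  pos₁≡ = punchIn-< (s≤s a<m)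

  oldPos-upto-a : ∀ {k} → k ≤ a → oldPos k ≡ k
  oldPos-upto-a k≤a = trans (cong (punchIn (suc m)) (punchIn-< (s≤s k≤a))) (punchIn-< (s≤s (≤-trans k≤a (<⇒≤ a<m))))

  oldPos-after : ∀ {k} → suc a ≤ k → k < m → oldPos k ≡ suc k
  oldPos-after a<k k<m = trans (cong (punchIn (suc m)) (punchIn-≥ a<k)) (punchIn-< (s≤s k<m))

  oldPos≤ : ∀ {k} → k < m → oldPos k ≤ suc k
  oldPos≤ {k} k<m with <-≤-connex a k
  ... | inj₁ a<k = ≤-reflexive (oldPos-after a<k k<m)
  ... | inj₂ k≤a = subst (_≤ suc k) (sym (oldPos-upto-a k≤a)) (n≤1+n k)

  oldVal-low : ∀ {r} → r < pred a → oldVal r ≡ r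
  oldVal-low r<σ-max = trans (cong (punchIn m) (punchIn-< r<σ-max)) (punchIn-< (<-trans r<σ-max σ-max<m))

  oldVal-mid : ∀ {r} → pred a ≤ r → suc r < m → oldVal r ≡ suc r
  oldVal-mid σ-max≤r r+1<m = trans (cong (punchIn m) (punchIn-≥ σ-max≤r)) (punchIn-< r+1<m)

  oldVal-top : oldVal (pred m) ≡ suc m
  oldVal-top = trans (cong (punchIn m) (trans (punchIn-≥ (pred-mono-≤ (<⇒≤ a<m))) (0<⇒suc-pred≡ 0<m))) (punchIn-≥ ≤-refl)

  oldVal-σ-max : oldVal (pred a) ≡ a
  oldVal-σ-max = trans (oldVal-mid ≤-refl (subst (_< m) (sym (0<⇒suc-pred≡ 0<a)) a<m)) (0<⇒suc-pred≡ 0<a)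

  oldVal≥ : ∀ r → r ≤ oldVal r
  oldVal≥ r = ≤-trans (punchIn-≤ (pred a) r) (punchIn-≤ m _)

  oldVal-σ≤a : ∀ {r} → r < a → oldVal r ≤ a
  oldVal-σ≤a {r} r<a with <-≤-connex r (pred a)
  ... | inj₁ r<σ-max = subst (_≤ a) (sym (oldVal-low r<σ-max)) (<⇒≤ r<a)
  ... | inj₂ σ-max≤r = subst (_≤ a) (sym (trans (cong oldVal (≤-antisym (pred-mono-≤ r<a) σ-max≤r)) oldVal-σ-max)) ≤-refl

  val-x : val ζ (suc m) ≡ m
  val-x = val-p₂

  val-y : val ζ (suc a) ≡ pred a
  val-y = trans (cong (val ζ) (sym pos₁≡)) (trans val-pos₁ (punchIn-< σ-max<m))

  ρ<a⇒<a : ∀ {k} → val ρ k < a → k < a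
  ρ<a⇒<a {k} lt with <-≤-connex k a
  ... | inj₁ k<a = k<a
  ... | inj₂ a≤k = ⊥-elim (<⇒≱ lt (⊕-val-right≥ σ τ a≤k))

  first<n : 0 < size π
  first<n = subst (0 <_) (sym π≡) (s≤s z≤n)

  last<n : last < size π
  last<n = subst (last <_) (sym π≡) (n<1+n last)

  2≤last : 2 ≤ last
  2≤last = ≤-pred (subst (3 ≤_) π≡ ([ ≤-trans (n≤1+n 3) , ≤-reflexive ∘ sym ∘ proj₁ ] long-or-321))

  above-last : ∀ {i} → i < last → val π last < val π i
  above-last i<last = ≤∧≢⇒< (last-min (<-trans i<last last<n))
                            (λ eq → <⇒≢ i<last (sym (val-injective π last<n (<-trans i<last last<n) eq)))

  -- If π's last entry sits on y, the earlier entries of π lie before and above y, so on the largest entry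
  -- of σ or on the first entry of τ, in this order; this leaves no room for π.
  module LastOnY (g : π ⊑ ζ) (last-on-y : pos g last ≡ suc a) where

    SigmaMaxOrTauFirst : ℕ → Set
    SigmaMaxOrTauFirst k = val ρ k ≡ pred a ⊎ k ≡ a

    landing : ∀ {i} → i < last → Σ ℕ λ k → k < m × oldPos k ≡ pos g i × SigmaMaxOrTauFirst k
    landing {i} i<last with position-cases (pos< g (<-trans i<last last<n))
    ... | inj₁ on-x = ⊥-elim (<-asym (subst₂ _<_ on-x last-on-y (pos-mono g i<last last<n)) (s≤s a<m))
    ... | inj₂ (inj₁ on-y) = ⊥-elim (<⇒≢ i<last (pos-injective g (<-trans i<last last<n) last<n
                                                     (trans on-y (trans pos₁≡ (sym last-on-y)))))
    ... | inj₂ (inj₂ (k , k<m , k↦i)) = k , k<m , k↦i , class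
      where
      above-y : pred a < oldVal (val ρ k)
      above-y = subst₂ _<_ (trans (cong (val ζ) last-on-y) val-y) (trans (cong (val ζ) (sym k↦i)) (val-oldPos k))
                           (preserves-< g last<n (<-trans i<last last<n) (above-last i<last))
      before-y : oldPos k < suc a
      before-y = subst₂ _<_ (sym k↦i) last-on-y (pos-mono g i<last last<n)
      k≤a : k ≤ a
      k≤a with <-≤-connex a k
      ... | inj₂ k≤a = k≤a
      ... | inj₁ a<k = ⊥-elim (<-asym before-y (subst (suc a <_) (sym (oldPos-after a<k k<m)) (s≤s a<k)))
      class : SigmaMaxOrTauFirst k
      class with m≤n⇒m<n∨m≡n k≤a
      ... | inj₂ k≡a = inj₂ k≡a
      ... | inj₁ k<a with <-≤-connex (val ρ k) (pred a)
      ...   | inj₁ low = ⊥-elim (<-asym above-y (subst (_< pred a) (sym (oldVal-low low)) low))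
      ...   | inj₂ σ-max≤ = inj₁ (≤-antisym (pred-mono-≤ (⊕-val-left< σ τ k<a)) σ-max≤)

    ordered : ∀ {i j kᵢ kⱼ} → i < j → j < last → kᵢ < m → kⱼ < m → oldPos kᵢ ≡ pos g i → oldPos kⱼ ≡ pos g j →
              SigmaMaxOrTauFirst kᵢ → SigmaMaxOrTauFirst kⱼ → val ρ kᵢ ≡ pred a × kⱼ ≡ a
    ordered {kᵢ = kᵢ} {kⱼ} i<j j<last kᵢ<m kⱼ<m kᵢ↦i kⱼ↦j = by-class
      where
      kᵢ<kⱼ : kᵢ < kⱼ
      kᵢ<kⱼ = oldPos-cancel (subst₂ _<_ (sym kᵢ↦i) (sym kⱼ↦j) (pos-mono g i<j (<-trans j<last last<n)))
      by-class : SigmaMaxOrTauFirst kᵢ → SigmaMaxOrTauFirst kⱼ → val ρ kᵢ ≡ pred a × kⱼ ≡ a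
      by-class (inj₁ kᵢ↦σ-max) (inj₂ kⱼ≡a) = kᵢ↦σ-max , kⱼ≡a
      by-class (inj₂ kᵢ≡a) (inj₂ kⱼ≡a) = ⊥-elim (<-irrefl (trans kᵢ≡a (sym kⱼ≡a)) kᵢ<kⱼ)
      by-class (inj₁ kᵢ↦σ-max) (inj₁ kⱼ↦σ-max) =
        ⊥-elim (<-irrefl (val-injective ρ kᵢ<m kⱼ<m (trans kᵢ↦σ-max (sym kⱼ↦σ-max))) kᵢ<kⱼ)
      by-class (inj₂ kᵢ≡a) (inj₁ kⱼ↦σ-max) =
        ⊥-elim (<-asym (subst (_< kⱼ) kᵢ≡a kᵢ<kⱼ) (ρ<a⇒<a (subst (_< a) (sym kⱼ↦σ-max) σ-max<a)))

    τ-first≥a : ∀ {k} → k ≡ a → a ≤ val ρ k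
    τ-first≥a refl = ⊕-val-right≥ σ τ ≤-refl

    impossible : ⊥
    impossible with landing (≤-trans (s≤s z≤n) 2≤last) | landing 2≤last
    ... | k₀ , k₀<m , k₀↦0 , c₀ | k₁ , k₁<m , k₁↦1 , c₁ =
      by-shape long-or-321 (ordered (s≤s z≤n) 2≤last k₀<m k₁<m k₀↦0 k₁↦1 c₀ c₁)
      where
      by-shape : 4 ≤ size π ⊎ (size π ≡ 3 × val π 1 < val π 0) → val ρ k₀ ≡ pred a × k₁ ≡ a → ⊥
      by-shape (inj₂ (_ , π₁<π₀)) (k₀↦σ-max , k₁≡a) = <-asym π₁<π₀ (reflects-< g first<n 1<n
        (subst₂ _<_ (trans (sym (val-oldPos k₀)) (cong (val ζ) k₀↦0)) (trans (sym (val-oldPos k₁)) (cong (val ζ) k₁↦1))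
                    (oldVal-mono (subst (_< val ρ k₁) (sym k₀↦σ-max) (<-≤-trans σ-max<a (τ-first≥a k₁≡a))))))
        where
        1<n : 1 < size π
        1<n = <-trans 2≤last last<n
      by-shape (inj₁ 4≤n) (_ , k₁≡a) with landing (≤-pred (subst (4 ≤_) π≡ 4≤n))
      ... | k₂ , k₂<m , k₂↦2 , c₂ = <⇒≱ (subst (_< a) (sym (proj₁ (ordered (n<1+n 1) (≤-pred (subst (4 ≤_) π≡ 4≤n))
                                                                        k₁<m k₂<m k₁↦1 k₂↦2 c₁ c₂))) σ-max<a)
                                        (τ-first≥a k₁≡a)

  -- Once π's last entry is an old one, x lies after it and y either below it or after it, so π embeds in σ ⊕ τ.
  π⋢ζ : ¬ π ⊑ ζ
  π⋢ζ g with position-cases (pos< g last<n)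
  ... | inj₁ last-on-x = TwoAbove-avoids-secondMax g refl last<n (trans (cong (val ζ) last-on-x) val-x)
                           (0 , 1 , first<n , <-trans 2≤last last<n , (λ ()) ,
                            above-last (≤-trans (s≤s z≤n) 2≤last) , above-last 2≤last)
  ... | inj₂ (inj₁ last-on-y) = LastOnY.impossible g (trans last-on-y pos₁≡)
  ... | inj₂ (inj₂ (k , k<m , k↦last)) = ⊕-avoid π≡ last<first σ-avoids τ-avoids (⊑-factor-avoiding g not-new)
    where
    not-new : ∀ {i} → i < size π → pos g i ≢ suc m × pos g i ≢ pos₁
    not-new {i} i<n with m≤n⇒m<n∨m≡n (≤-pred (subst (i <_) π≡ i<n))
    ... | inj₂ refl = oldPos≢p₂ k ∘ trans k↦last , oldPos≢pos₁ k ∘ trans k↦last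
    ... | inj₁ i<last = not-x , not-y
      where
      before-last : pos g i < oldPos k
      before-last = subst (pos g i <_) (sym k↦last) (pos-mono g i<last last<n)
      not-x : pos g i ≢ suc m
      not-x on-x = <⇒≱ (subst (_< oldPos k) on-x before-last) (≤-trans (oldPos≤ k<m) (s≤s (<⇒≤ k<m)))
      not-y : pos g i ≢ pos₁
      not-y on-y with <-≤-connex k a
      ... | inj₁ k<a = <⇒≱ (subst (_< oldPos k) (trans on-y pos₁≡) before-last)
                           (subst (_≤ suc a) (sym (oldPos-upto-a (<⇒≤ k<a))) (≤-trans (<⇒≤ k<a) (n≤1+n a)))
      ... | inj₂ a≤k = <⇒≱ (subst₂ _<_ (trans (cong (val ζ) (sym k↦last)) (val-oldPos k))
                                       (trans (cong (val ζ) (trans on-y pos₁≡)) val-y)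
                                       (preserves-< g last<n i<n (above-last i<last)))
                           (≤-trans (≤-trans pred[n]≤n (⊕-val-right≥ σ τ a≤k)) (oldVal≥ _))

  noSkew : NoSkew ζ
  noSkew k (0<k , k<N , sep) =
    <⇒≱ (subst₂ _<_ val-x (val-oldPos 0) (sep (subst (_< k) (sym (oldPos-upto-a z≤n)) 0<k) (≤-pred k<N) ≤-refl))
        (≤-trans (oldVal-σ≤a (⊕-val-left< σ τ 0<a)) (<⇒≤ a<m))

  -- A sum split of ζ left of y restricts to σ, unless the maximum of σ lies left of it; one right of y to τ.
  noSum : NoSum ζ
  noSum k split@(0<k , k<N , sep) with m≤n⇒m<n∨m≡n (≤-pred k<N)
  ... | inj₂ refl with val-surjective ρ (0<⇒pred< 0<m)
  ...   | t , t<m , vt≡top = <-asym (subst₂ _<_ (trans (val-oldPos t) (trans (cong oldVal vt≡top) oldVal-top)) val-x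
                                     (sep (≤-<-trans (oldPos≤ t<m) (s≤s t<m)) ≤-refl ≤-refl))
                                 (n<1+n m)
  noSum k split@(0<k , k<N , sep) | inj₁ k≤m with <-≤-connex (suc a) k
  ... | inj₂ k≤a+1 with val-surjective ρ σ-max<m
  ...   | t , t<m , vt≡σ-max with ρ<a⇒<a (subst (_< a) (sym vt≡σ-max) σ-max<a)
  ...     | t<a with <-≤-connex t k
  ...       | inj₁ t<k = <-asym (subst₂ _<_ (trans (val-oldPos t) (trans (cong oldVal vt≡σ-max) oldVal-σ-max)) val-y
                                  (sep (subst (_< k) (sym (oldPos-upto-a (<⇒≤ t<a))) t<k) k≤a+1 (s≤s (s≤s (<⇒≤ a<m)))))
                              σ-max<a
  ...       | inj₂ k≤t = σ-noSum k (SumSplit-restrict (⊑-trans (⊑-⊕ˡ σ τ) ω⊑ζ) split 0<k (≤-<-trans k≤t t<a)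
                           (λ u<k → subst (_< k) (sym (oldPos-upto-a (≤-trans (<⇒≤ u<k) (≤-trans k≤t (<⇒≤ t<a))))) u<k)
                           (λ k≤u u<a → subst (k ≤_) (sym (oldPos-upto-a (<⇒≤ u<a))) k≤u))
  noSum k split@(0<k , k<N , sep) | inj₁ k≤m | inj₁ a+1<k =
    τ-noSum k′ (SumSplit-restrict (⊑-trans (⊑-⊕ʳ σ τ) ω⊑ζ) split 0<k′ k′<b before after)
    where
    k′ : ℕ
    k′ = k ∸ suc a
    k≡ : suc a + k′ ≡ k
    k≡ = m+[n∸m]≡n (<⇒≤ a+1<k)
    0<k′ : 0 < k′
    0<k′ = +-cancelˡ-< (suc a) 0 k′ (subst₂ _<_ (sym (+-identityʳ (suc a))) (sym k≡) a+1<k)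
    k′<b : k′ < b
    k′<b = +-cancelˡ-< (suc a) k′ b (subst (_< suc a + b) (sym k≡) (s≤s (≤-pred k≤m)))
    before : ∀ {u} → u < k′ → oldPos (a + u) < k
    before {u} u<k′ = ≤-<-trans (oldPos≤ a+u<m) (subst (suc (a + u) <_) k≡ (+-monoʳ-< (suc a) u<k′))
      where
      a+u<m : a + u < m
      a+u<m = +-monoʳ-< a (<-trans u<k′ k′<b)
    after : ∀ {u} → k′ ≤ u → u < b → k ≤ oldPos (a + u)
    after {u} k′≤u u<b = subst (k ≤_) (sym (oldPos-after a+1≤a+u (+-monoʳ-< a u<b)))
                                (subst (_≤ suc (a + u)) k≡ (+-monoʳ-≤ (suc a) k′≤u))
      where
      a+1≤a+u : suc a ≤ a + u
      a+1≤a+u = subst (_≤ a + u) (+-comm a 1) (+-monoʳ-≤ a (≤-trans 0<k′ k′≤u))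

  result : Extension π (σ ⊕ τ)
  result = ζ , ω⊑ζ , π⋢ζ , noSum , noSkew

-- Induction on ω

private
  SeparatedBy : (ℕ → ℕ → Set) → ℕPerm → ℕ → Set
  SeparatedBy _R_ ω k = ∀ {i} → i < k → ∀ {i′} → i′ < size ω → k ≤ i′ → val ω i R val ω i′

SumSplit? : ∀ ω k → Dec (SumSplit ω k)
SumSplit? ω k = map′ {A = 0 < k × k < size ω × SeparatedBy _<_ ω k}
  (λ (0<k , k<n , sep) → 0<k , k<n , λ i<k k≤i′ i′<n → sep i<k i′<n k≤i′)
  (λ (0<k , k<n , sep) → 0<k , k<n , λ i<k i′<n k≤i′ → sep i<k k≤i′ i′<n)
  (0 <? k ×-dec k <? size ω ×-dec
   allUpTo? (λ i → allUpTo? (λ i′ → k ≤? i′ →-dec val ω i <? val ω i′) (size ω)) k)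

SkewSplit? : ∀ ω k → Dec (SkewSplit ω k)
SkewSplit? ω k = map′ {A = 0 < k × k < size ω × SeparatedBy _>_ ω k}
  (λ (0<k , k<n , sep) → 0<k , k<n , λ i<k k≤i′ i′<n → sep i<k i′<n k≤i′)
  (λ (0<k , k<n , sep) → 0<k , k<n , λ i<k i′<n k≤i′ → sep i<k k≤i′ i′<n)
  (0 <? k ×-dec k <? size ω ×-dec
   allUpTo? (λ i → allUpTo? (λ i′ → k ≤? i′ →-dec val ω i′ <? val ω i) (size ω)) k)

TwoAbove? : ∀ π i → Dec (TwoAbove π i)
TwoAbove? π i = map′ (λ (j , j<n , j′ , j′<n , rest) → j , j′ , j<n , j′<n , rest)
                     (λ (j , j′ , j<n , j′<n , rest) → j , j<n , j′ , j′<n , rest)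
  (anyUpTo? (λ j → anyUpTo? (λ j′ → ¬? (j ≟ j′) ×-dec val π i <? val π j ×-dec val π i <? val π j′) (size π)) (size π))
TwoBelow? : ∀ π i → Dec (TwoBelow π i)
TwoBelow? π i = map′ (λ (j , j<n , j′ , j′<n , rest) → j , j′ , j<n , j′<n , rest)
                     (λ (j , j′ , j<n , j′<n , rest) → j , j<n , j′ , j′<n , rest)
  (anyUpTo? (λ j → anyUpTo? (λ j′ → ¬? (j ≟ j′) ×-dec val π j <? val π i ×-dec val π j′ <? val π i) (size π)) (size π))
Above? : ∀ π i → Dec (Above π i)
Above? π i = anyUpTo? (λ j → val π i <? val π j) (size π)
Below? : ∀ π i → Dec (Below π i)
Below? π i = anyUpTo? (λ j → val π j <? val π i) (size π)

-- The patterns of size at least 3 outside the exceptional set: 123, 321 and all longer ones.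
data Admissible (π : ℕPerm) : Set where
  long       : 4 ≤ size π → Admissible π
  increasing : size π ≡ 3 → val π 0 < val π 1 → val π 1 < val π 2 → Admissible π
  decreasing : size π ≡ 3 → val π 1 < val π 0 → val π 2 < val π 1 → Admissible π

Admissible-complement : ∀ {π} → Admissible π → Admissible (complement π)
Admissible-complement (long 4≤n) = long 4≤n
Admissible-complement {π} (increasing π≡3 v₀<v₁ v₁<v₂) =
  decreasing π≡3 (∸suc-mono v₀<v₁ (val< π (<3 (s≤s (s≤s z≤n))))) (∸suc-mono v₁<v₂ (val< π (<3 ≤-refl)))
  where
  <3 : ∀ {i} → i < 3 → i < size π
  <3 = subst (_ <_) (sym π≡3)
Admissible-complement {π} (decreasing π≡3 v₁<v₀ v₂<v₁) =
  increasing π≡3 (∸suc-mono v₁<v₀ (val< π (<3 (s≤s z≤n)))) (∸suc-mono v₂<v₁ (val< π (<3 (s≤s (s≤s z≤n)))))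
  where
  <3 : ∀ {i} → i < 3 → i < size π
  <3 = subst (_ <_) (sym π≡3)

Extension-⊑ : ∀ {π ω ω′} → ω ⊑ ω′ → Extension π ω′ → Extension π ω
Extension-⊑ ω⊑ω′ (ζ , ω′⊑ζ , rest) = ζ , ⊑-trans ω⊑ω′ ω′⊑ζ , rest

Extension-complement : ∀ {π ω} → Extension (complement π) (complement ω) → Extension π ω
Extension-complement {ω = ω} (ζ , ωᶜ⊑ζ , πᶜ⋢ζ , noSum , noSkew) =
  complement ζ , ⊑-trans (⊑-complement² ω) (complement-⊑ ωᶜ⊑ζ) ,
  (λ π⊑ζᶜ → πᶜ⋢ζ (⊑-trans (complement-⊑ π⊑ζᶜ) (complement²-⊑ ζ))) ,
  (λ k split → noSkew k (complement-SumSplit ζ split)) , (λ k split → noSum k (complement-SkewSplit ζ split))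

complement-avoids : ∀ {π ω} → ¬ π ⊑ ω → ¬ complement π ⊑ complement ω
complement-avoids {π} {ω} π⋢ω πᶜ⊑ωᶜ =
  π⋢ω (⊑-trans (⊑-complement² π) (⊑-trans (complement-⊑ πᶜ⊑ωᶜ) (complement²-⊑ ω)))

module AdmissibleShape (π : ℕPerm) (adm : Admissible π) where

  3≤n : 3 ≤ size π
  3≤n = at-least-3 adm
    where
    at-least-3 : Admissible π → 3 ≤ size π
    at-least-3 (long 4≤n) = ≤-trans (n≤1+n 3) 4≤n
    at-least-3 (increasing π≡3 _ _) = ≤-reflexive (sym π≡3)
    at-least-3 (decreasing π≡3 _ _) = ≤-reflexive (sym π≡3)

  last : ℕ
  last = pred (size π)

  π≡ : size π ≡ suc last
  π≡ = sym (0<⇒suc-pred≡ (≤-trans (s≤s z≤n) 3≤n))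

  2≤last : 2 ≤ last
  2≤last = ≤-pred (subst (3 ≤_) π≡ 3≤n)

  index< : ∀ {i} → i ≤ last → i < size π
  index< i≤last = subst (_ <_) (sym π≡) (s≤s i≤last)

  first<n : 0 < size π
  last<n : last < size π
  1<n : 1 < size π
  2<n : 2 < size π
  first<n = index< z≤n
  last<n = index< ≤-refl
  1<n = index< (≤-trans (s≤s z≤n) 2≤last)
  2<n = index< 2≤last

  size3⇒last≡2 : size π ≡ 3 → last ≡ 2
  size3⇒last≡2 = cong pred

  first≢last : val π 0 ≢ val π last
  first≢last eq = <⇒≢ (≤-trans (s≤s z≤n) 2≤last) (val-injective π first<n last<n eq)

module _ {π ω k} (adm : Admissible π) (avoids : ¬ π ⊑ ω) (split : SumSplit ω k) where

  open AdmissibleShape π adm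

  private
    0<k : 0 < k
    0<k = proj₁ split
    k<M : k < size ω
    k<M = proj₁ (proj₂ split)
    2≤M : 2 ≤ size ω
    2≤M = ≤-trans (s≤s 0<k) k<M
    0<M : 0 < size ω
    0<M = ≤-trans (s≤s z≤n) 2≤M
    ω-first<last : val ω 0 < val ω (pred (size ω))
    ω-first<last = proj₂ (proj₂ split) 0<k (pred-mono-≤ k<M) (0<⇒pred< 0<M)

  extension-ascending : val π 0 < val π last → Extension π ω
  extension-ascending first<last with TwoAbove? π 0 | TwoBelow? π last
  ... | yes twoAbove | yes twoBelow = FramedBySecondExtremes.result π ω 2≤M ω-first<last avoids last π≡ twoAbove twoBelow
  ... | no ¬twoAbove | _ = StartingSecondMinMax.result π ω 2≤M ω-first<last avoids twoBelow-first aboveStart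
    where
    below-first : ∀ {i} → i < size π → i ≢ 0 → i ≢ last → val π i < val π 0
    below-first {i} i<n i≢0 i≢last with <-cmp (val π i) (val π 0)
    ... | tri< lt _ _ = lt
    ... | tri≈ _ eq _ = ⊥-elim (i≢0 (val-injective π i<n first<n eq))
    ... | tri> _ _ gt = ⊥-elim (¬twoAbove (i , last , i<n , last<n , i≢last , gt , first<last))
    3≤last : 3 ≤ last
    3≤last = by-shape adm
      where
      by-shape : Admissible π → 3 ≤ last
      by-shape (long 4≤n) = ≤-pred (subst (4 ≤_) π≡ 4≤n)
      by-shape (increasing _ v₀<v₁ v₁<v₂) = ⊥-elim (¬twoAbove (1 , 2 , 1<n , 2<n , (λ ()) , v₀<v₁ , <-trans v₀<v₁ v₁<v₂))
      by-shape (decreasing π≡3 v₁<v₀ v₂<v₁) =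
        ⊥-elim (<-asym first<last (subst (λ j → val π j < val π 0) (sym (size3⇒last≡2 π≡3)) (<-trans v₂<v₁ v₁<v₀)))
    twoBelow-first : TwoBelow π 0
    twoBelow-first = 1 , 2 , 1<n , 2<n , (λ ()) , below-first 1<n (λ ()) (<⇒≢ (≤-trans (s≤s (s≤s z≤n)) 3≤last))
                                               , below-first 2<n (λ ()) (<⇒≢ 3≤last)
    aboveStart : ∀ {i} → i < size π → i ≤ 1 → Above π i
    aboveStart {zero} _ _ = last , last<n , first<last
    aboveStart {suc zero} _ _ = 0 , first<n , below-first 1<n (λ ()) (<⇒≢ (≤-trans (s≤s (s≤s z≤n)) 3≤last))
    aboveStart {suc (suc _)} _ (s≤s ())
  ... | yes twoAbove | no ¬twoBelow = EndingMinSecondMax.result π ω 2≤M ω-first<last avoids last π≡ twoAbove-last belowEnd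
    where
    above-last : ∀ {i} → i < size π → i ≢ 0 → i ≢ last → val π last < val π i
    above-last {i} i<n i≢0 i≢last with <-cmp (val π last) (val π i)
    ... | tri< lt _ _ = lt
    ... | tri≈ _ eq _ = ⊥-elim (i≢last (sym (val-injective π last<n i<n eq)))
    ... | tri> _ _ gt = ⊥-elim (¬twoBelow (i , 0 , i<n , first<n , i≢0 , gt , first<last))
    3≤last : 3 ≤ last
    3≤last = by-shape adm
      where
      by-shape : Admissible π → 3 ≤ last
      by-shape (long 4≤n) = ≤-pred (subst (4 ≤_) π≡ 4≤n)
      by-shape (increasing π≡3 v₀<v₁ v₁<v₂) = ⊥-elim (¬twoBelow (0 , 1 , first<n , 1<n , (λ ()) ,
        subst (λ j → val π 0 < val π j) (sym (size3⇒last≡2 π≡3)) (<-trans v₀<v₁ v₁<v₂) ,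
        subst (λ j → val π 1 < val π j) (sym (size3⇒last≡2 π≡3)) v₁<v₂))
      by-shape (decreasing π≡3 v₁<v₀ v₂<v₁) =
        ⊥-elim (<-asym first<last (subst (λ j → val π j < val π 0) (sym (size3⇒last≡2 π≡3)) (<-trans v₂<v₁ v₁<v₀)))
    twoAbove-last : TwoAbove π last
    twoAbove-last = 1 , 2 , 1<n , 2<n , (λ ()) , above-last 1<n (λ ()) (<⇒≢ (≤-trans (s≤s (s≤s z≤n)) 3≤last))
                                               , above-last 2<n (λ ()) (<⇒≢ 3≤last)
    belowEnd : ∀ {i} → i < size π → last ≤ suc i → Below π i
    belowEnd {i} i<n last≤i+1 with m≤n⇒m<n∨m≡n (≤-pred (subst (i <_) π≡ i<n))
    ... | inj₂ refl = 0 , first<n , first<last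
    ... | inj₁ i<last = last , last<n , above-last i<n i≢0 (<⇒≢ i<last)
      where
      i≢0 : i ≢ 0
      i≢0 refl = <⇒≱ (≤-trans (s≤s (s≤s z≤n)) 3≤last) last≤i+1

  extension-descending : val π last < val π 0 →
                         Extension π (leftSummand ω split) → Extension π (rightSummand ω split) → Extension π ω
  extension-descending last<first (σ , α⊑σ , σ-avoids , σ-noSum , _) (τ , β⊑τ , τ-avoids , τ-noSum , _) =
    by-extremes (Above? π 0) (Below? π last)
    where
    0<a : 0 < size σ
    0<a = ≤-<-trans z≤n (pos< α⊑σ 0<k)
    0<b : 0 < size τ
    0<b = ≤-<-trans z≤n (pos< β⊑τ (m<n⇒0<n∸m k<M))
    through-sum : Extension π (σ ⊕ τ) → Extension π ω
    through-sum = Extension-⊑ (⊑-trans (SumSplit⇒⊑⊕ ω split) (⊕-mono-⊑ α⊑σ β⊑τ))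
    by-extremes : Dec (Above π 0) → Dec (Below π last) → Extension π ω
    by-extremes (no ¬above) _ = through-sum (MaxFirstOverSum.result π σ τ 0<a 0<b σ-noSum τ-noSum σ-avoids τ-avoids
                                                last π≡ last<first first-max long-or-321)
      where
      first-max : ∀ {j} → j < size π → val π j ≤ val π 0
      first-max j<n = ≮⇒≥ (λ lt → ¬above (_ , j<n , lt))
      long-or-321 : 4 ≤ size π ⊎ size π ≡ 3 × val π 2 < val π 1
      long-or-321 = by-shape adm
        where
        by-shape : Admissible π → 4 ≤ size π ⊎ size π ≡ 3 × val π 2 < val π 1
        by-shape (long 4≤n) = inj₁ 4≤n
        by-shape (increasing _ v₀<v₁ _) = ⊥-elim (¬above (1 , 1<n , v₀<v₁))
        by-shape (decreasing π≡3 _ v₂<v₁) = inj₂ (π≡3 , v₂<v₁)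
    by-extremes (yes _) (no ¬below) = through-sum (MinLastOverSum.result π σ τ 0<a 0<b σ-noSum τ-noSum σ-avoids τ-avoids
                                                     last π≡ last<first last-min long-or-321)
      where
      last-min : ∀ {j} → j < size π → val π last ≤ val π j
      last-min j<n = ≮⇒≥ (λ lt → ¬below (_ , j<n , lt))
      long-or-321 : 4 ≤ size π ⊎ size π ≡ 3 × val π 1 < val π 0
      long-or-321 = by-shape adm
        where
        by-shape : Admissible π → 4 ≤ size π ⊎ size π ≡ 3 × val π 1 < val π 0
        by-shape (long 4≤n) = inj₁ 4≤n
        by-shape (increasing π≡3 v₀<v₁ v₁<v₂) =
          ⊥-elim (<-asym last<first (subst (λ j → val π 0 < val π j) (sym (size3⇒last≡2 π≡3)) (<-trans v₀<v₁ v₁<v₂)))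
        by-shape (decreasing π≡3 v₁<v₀ _) = inj₂ (π≡3 , v₁<v₀)
    by-extremes (yes above) (yes below) = MaxMinAtSplit.result π ω split avoids last π≡ last<first above below

  sum-case : (∀ {ω′} → size ω′ < size ω → ¬ π ⊑ ω′ → Extension π ω′) → Extension π ω
  sum-case recurse with <-cmp (val π 0) (val π last)
  ... | tri< first<last _ _ = extension-ascending first<last
  ... | tri≈ _ first≡last _ = ⊥-elim (first≢last first≡last)
  ... | tri> _ _ last<first = extension-descending last<first
          (recurse k<M (avoids ∘ λ π⊑α → ⊑-trans π⊑α (leftSummand-⊑ ω split)))
          (recurse (∸-monoʳ-< 0<k (<⇒≤ k<M)) (avoids ∘ λ π⊑β → ⊑-trans π⊑β (rightSummand-⊑ ω split)))

-- By induction on size ω, for all admissible π at once: the complement reduces the skew case to the sum case.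
extension : ∀ ω {π} → Admissible π → ¬ π ⊑ ω → Extension π ω
extension = All.wfRec (On.wellFounded size <-wellFounded) _ (λ ω → ∀ {π} → Admissible π → ¬ π ⊑ ω → Extension π ω) step
  where
  step : ∀ ω → (∀ {ω′} → size ω′ < size ω → ∀ {π} → Admissible π → ¬ π ⊑ ω′ → Extension π ω′) →
         ∀ {π} → Admissible π → ¬ π ⊑ ω → Extension π ω
  step ω recurse adm avoids with anyUpTo? (SumSplit? ω) (size ω) | anyUpTo? (SkewSplit? ω) (size ω)
  ... | yes (_ , _ , split) | _ = sum-case adm avoids split (λ smaller → recurse smaller adm)
  ... | no _ | yes (_ , _ , split) =
    Extension-complement (sum-case (Admissible-complement adm) (complement-avoids avoids) (SkewSplit-complement ω split)
                                   (λ smaller → recurse smaller (Admissible-complement adm)))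
  ... | no ¬sum | no ¬skew = ω , ⊑-refl ω , avoids , (λ k split → ¬sum (k , proj₁ (proj₂ split) , split))
                                                     , (λ k split → ¬skew (k , proj₁ (proj₂ split) , split))

extendℕ : ∀ {m} → (Fin m → ℕ) → ℕ → ℕ
extendℕ {m} h i with i <? m
... | yes i<m = h (fromℕ< i<m)
... | no _ = 0

extendℕ-fromℕ< : ∀ {m} (h : Fin m → ℕ) {i} (i<m : i < m) → extendℕ h i ≡ h (fromℕ< i<m)
extendℕ-fromℕ< {m} h {i} i<m with i <? m
... | yes _ = refl
... | no i≮m = ⊥-elim (i≮m i<m)

extendℕ-toℕ : ∀ {m} (h : Fin m → ℕ) (i : Fin m) → extendℕ h (toℕ i) ≡ h i
extendℕ-toℕ h i = trans (extendℕ-fromℕ< h (FP.toℕ<n i)) (cong h (FP.fromℕ<-toℕ i (FP.toℕ<n i)))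

entry : Perm → ℕ → ℕ
entry P = extendℕ (toℕ ∘ fun P)

toℕPerm : Perm → ℕPerm
toℕPerm P = mkℕPerm (len P) (entry P) entry< entry-injective
  where
  entry< : ∀ {i} → i < len P → entry P i < len P
  entry< i<n = subst (_< len P) (sym (extendℕ-fromℕ< _ i<n)) (FP.toℕ<n _)
  entry-injective : ∀ {i j} → i < len P → j < len P → entry P i ≡ entry P j → i ≡ j
  entry-injective {i} {j} i<n j<n eq = begin
    i                  ≡⟨ FP.toℕ-fromℕ< i<n ⟨
    toℕ (fromℕ< i<n)   ≡⟨ cong toℕ (inj P (FP.toℕ-injective (begin
      toℕ (fun P (fromℕ< i<n))   ≡⟨ extendℕ-fromℕ< _ i<n ⟨
      entry P i                  ≡⟨ eq ⟩
      entry P j                  ≡⟨ extendℕ-fromℕ< _ j<n ⟩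
      toℕ (fun P (fromℕ< j<n))   ∎))) ⟩
    toℕ (fromℕ< j<n)   ≡⟨ FP.toℕ-fromℕ< j<n ⟩
    j                  ∎
    where open ≡-Reasoning

fromℕPerm : ℕPerm → Perm
fromℕPerm ρ = perm (size ρ) (λ i → fromℕ< (val< ρ (FP.toℕ<n i))) injective
  where
  injective : ∀ {i j} → fromℕ< (val< ρ (FP.toℕ<n i)) ≡ fromℕ< (val< ρ (FP.toℕ<n j)) → i ≡ j
  injective {i} {j} eq = FP.toℕ-injective (val-injective ρ (FP.toℕ<n i) (FP.toℕ<n j)
    (FP.fromℕ<-injective _ _ (val< ρ (FP.toℕ<n i)) (val< ρ (FP.toℕ<n j)) eq))

entry-fromℕPerm : ∀ ρ {i} → i < size ρ → entry (fromℕPerm ρ) i ≡ val ρ i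
entry-fromℕPerm ρ i<n =
  trans (extendℕ-fromℕ< _ i<n) (trans (FP.toℕ-fromℕ< _) (cong (val ρ) (FP.toℕ-fromℕ< i<n)))

⊑-fromℕPerm : ∀ ρ → ρ ⊑ toℕPerm (fromℕPerm ρ)
⊑-fromℕPerm ρ = same-entries⇒⊑ refl (sym ∘ entry-fromℕPerm ρ)

fromℕPerm-⊑ : ∀ ρ → toℕPerm (fromℕPerm ρ) ⊑ ρ
fromℕPerm-⊑ ρ = same-entries⇒⊑ refl (entry-fromℕPerm ρ)

≼⇒⊑ : ∀ {α β} → α ≼ β → toℕPerm α ⊑ toℕPerm β
≼⇒⊑ {α} {β} (E , E-mono , E-order) = mk⊑ (extendℕ (toℕ ∘ E)) pos′< pos′-mono preserves reflects
  where
  pos′ : ℕ → ℕ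
  pos′ = extendℕ (toℕ ∘ E)
  pos′≡ : ∀ {i} (i<n : i < len α) → pos′ i ≡ toℕ (E (fromℕ< i<n))
  pos′≡ = extendℕ-fromℕ< (toℕ ∘ E)
  entryα : ∀ {i} (i<n : i < len α) → entry α i ≡ toℕ (fun α (fromℕ< i<n))
  entryα = extendℕ-fromℕ< (toℕ ∘ fun α)
  entryβ : ∀ {i} (i<n : i < len α) → entry β (pos′ i) ≡ toℕ (fun β (E (fromℕ< i<n)))
  entryβ i<n = trans (cong (entry β) (pos′≡ i<n)) (extendℕ-toℕ (toℕ ∘ fun β) _)
  pos′< : ∀ {i} → i < len α → pos′ i < len β
  pos′< i<n = subst (_< len β) (sym (pos′≡ i<n)) (FP.toℕ<n _)
  pos′-mono : ∀ {i j} → i < j → j < len α → pos′ i < pos′ j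
  pos′-mono {i} i<j j<n = subst₂ _<_ (sym (pos′≡ i<n)) (sym (pos′≡ j<n))
    (E-mono _ _ (subst₂ _<_ (sym (FP.toℕ-fromℕ< i<n)) (sym (FP.toℕ-fromℕ< j<n)) i<j))
    where
    i<n : i < len α
    i<n = <-trans i<j j<n
  preserves : ∀ {i j} → i < len α → j < len α → entry α i < entry α j → entry β (pos′ i) < entry β (pos′ j)
  preserves i<n j<n lt = subst₂ _<_ (sym (entryβ i<n)) (sym (entryβ j<n))
    (Equivalence.to (E-order _ _) (subst₂ _<_ (entryα i<n) (entryα j<n) lt))
  reflects : ∀ {i j} → i < len α → j < len α → entry β (pos′ i) < entry β (pos′ j) → entry α i < entry α j
  reflects i<n j<n lt = subst₂ _<_ (sym (entryα i<n)) (sym (entryα j<n))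
    (Equivalence.from (E-order _ _) (subst₂ _<_ (entryβ i<n) (entryβ j<n) lt))

⊑⇒≼ : ∀ {α β} → toℕPerm α ⊑ toℕPerm β → α ≼ β
⊑⇒≼ {α} {β} g = E , E-mono , E-order
  where
  E : Fin (len α) → Fin (len β)
  E i = fromℕ< (pos< g (FP.toℕ<n i))
  toℕ-E : ∀ i → toℕ (E i) ≡ pos g (toℕ i)
  toℕ-E i = FP.toℕ-fromℕ< _
  E-mono : ∀ i j → i Fin.< j → E i Fin.< E j
  E-mono i j i<j = subst₂ _<_ (sym (toℕ-E i)) (sym (toℕ-E j)) (pos-mono g i<j (FP.toℕ<n j))
  entryα : ∀ i → entry α (toℕ i) ≡ toℕ (fun α i)
  entryα = extendℕ-toℕ (toℕ ∘ fun α)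
  entryβ : ∀ i → entry β (pos g (toℕ i)) ≡ toℕ (fun β (E i))
  entryβ i = extendℕ-fromℕ< (toℕ ∘ fun β) (pos< g (FP.toℕ<n i))
  E-order : ∀ i j → (fun α i Fin.< fun α j) ⇔ (fun β (E i) Fin.< fun β (E j))
  E-order i j = mk⇔
    (λ lt → subst₂ _<_ (entryβ i) (entryβ j)
              (preserves-< g (FP.toℕ<n i) (FP.toℕ<n j) (subst₂ _<_ (sym (entryα i)) (sym (entryα j)) lt)))
    (λ lt → subst₂ _<_ (entryα i) (entryα j)
              (reflects-< g (FP.toℕ<n i) (FP.toℕ<n j) (subst₂ _<_ (sym (entryβ i)) (sym (entryβ j)) lt)))

module _ {a b} (f : Fin a → Fin a) (g : Fin b → Fin b) (k : Fin (a + b)) where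

  sumFun-< : toℕ k < a → toℕ (sumFun f g k) < a
  sumFun-< k<a rewrite FP.splitAt-< a k k<a = subst (_< a) (sym (FP.toℕ-↑ˡ _ b)) (FP.toℕ<n _)

  sumFun-≥ : a ≤ toℕ k → a ≤ toℕ (sumFun f g k)
  sumFun-≥ a≤k rewrite FP.splitAt-≥ a k a≤k = subst (a ≤_) (sym (FP.toℕ-↑ʳ a _)) (m≤m+n a _)

  skewFun-< : toℕ k < a → b ≤ toℕ (skewFun f g k)
  skewFun-< k<a rewrite FP.splitAt-< a k k<a = subst (b ≤_) (sym (FP.toℕ-↑ʳ b _)) (m≤m+n b _)

  skewFun-≥ : a ≤ toℕ k → toℕ (skewFun f g k) < b
  skewFun-≥ a≤k rewrite FP.splitAt-≥ a k a≤k = subst (_< b) (sym (FP.toℕ-↑ˡ _ a)) (FP.toℕ<n _)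

entry-cast : ∀ P {m k} (m≡n : m ≡ len P) (Q : Fin m → Fin k) →
             (∀ j → toℕ (Q j) ≡ toℕ (fun P (cast m≡n j))) →
             ∀ {i} (i<m : i < m) → entry P i ≡ toℕ (Q (fromℕ< i<m))
entry-cast P m≡n Q Q≗P {i} i<m = begin
  entry P i                            ≡⟨ extendℕ-fromℕ< _ i<n ⟩
  toℕ (fun P (fromℕ< i<n))             ≡⟨ cong (toℕ ∘ fun P) (FP.toℕ-injective (begin
    toℕ (fromℕ< i<n)                     ≡⟨ FP.toℕ-fromℕ< i<n ⟩
    i                                    ≡⟨ FP.toℕ-fromℕ< i<m ⟨
    toℕ (fromℕ< i<m)                     ≡⟨ FP.toℕ-cast m≡n _ ⟨
    toℕ (cast m≡n (fromℕ< i<m))          ∎)) ⟩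
  toℕ (fun P (cast m≡n (fromℕ< i<m)))  ≡⟨ Q≗P _ ⟨
  toℕ (Q (fromℕ< i<m))                 ∎
  where
  open ≡-Reasoning
  i<n : i < len P
  i<n = subst (i <_) m≡n i<m

module _ (P : Perm) {a b} (a+b≡n : a + b ≡ len P) where

  private
    <a+b : ∀ {i} → i < len P → i < a + b
    <a+b = subst (_ <_) (sym a+b≡n)

    toℕ-fromℕ<-< : ∀ {i} → i < a → (i<n : i < len P) → toℕ (fromℕ< (<a+b i<n)) < a
    toℕ-fromℕ<-< i<a i<n = subst (_< a) (sym (FP.toℕ-fromℕ< _)) i<a

    toℕ-fromℕ<-≥ : ∀ {i} → a ≤ i → (i<n : i < len P) → a ≤ toℕ (fromℕ< (<a+b i<n))
    toℕ-fromℕ<-≥ a≤i i<n = subst (a ≤_) (sym (FP.toℕ-fromℕ< _)) a≤i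

  SumDecomposable⇒SumSplit : ∀ {f g} → (∀ i → toℕ (sumFun f g i) ≡ toℕ (fun P (cast a+b≡n i))) →
                             0 < a → 0 < b → SumSplit (toℕPerm P) a
  SumDecomposable⇒SumSplit {f} {g} same 0<a 0<b = 0<a , a<n , sep
    where
    a<n : a < len P
    a<n = subst (a <_) a+b≡n (m<m+n a 0<b)
    sep : ∀ {i i′} → i < a → a ≤ i′ → i′ < len P → entry P i < entry P i′
    sep i<a a≤i′ i′<n = subst₂ _<_ (sym (entry-cast P a+b≡n (sumFun f g) same (<a+b (<-trans i<a a<n))))
                                   (sym (entry-cast P a+b≡n (sumFun f g) same (<a+b i′<n)))
      (<-≤-trans (sumFun-< f g _ (toℕ-fromℕ<-< i<a (<-trans i<a a<n))) (sumFun-≥ f g _ (toℕ-fromℕ<-≥ a≤i′ i′<n)))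

  SkewDecomposable⇒SkewSplit : ∀ {f g} → (∀ i → toℕ (skewFun f g i) ≡ toℕ (fun P (cast a+b≡n i))) →
                               0 < a → 0 < b → SkewSplit (toℕPerm P) a
  SkewDecomposable⇒SkewSplit {f} {g} same 0<a 0<b = 0<a , a<n , sep
    where
    a<n : a < len P
    a<n = subst (a <_) a+b≡n (m<m+n a 0<b)
    sep : ∀ {i i′} → i < a → a ≤ i′ → i′ < len P → entry P i′ < entry P i
    sep i<a a≤i′ i′<n = subst₂ _<_ (sym (entry-cast P a+b≡n (skewFun f g) same (<a+b i′<n)))
                                   (sym (entry-cast P a+b≡n (skewFun f g) same (<a+b (<-trans i<a a<n))))
      (<-≤-trans (skewFun-≥ f g _ (toℕ-fromℕ<-≥ a≤i′ i′<n)) (skewFun-< f g _ (toℕ-fromℕ<-< i<a (<-trans i<a a<n))))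

indecomposable : ∀ ζ → NoSum ζ → NoSkew ζ → Indecomposable (fromℕPerm ζ)
indecomposable ζ no-sum no-skew =
  (λ (a , b , a+b≡n , 0<a , 0<b , _ , _ , _ , _ , same) →
     no-sum a (SumSplit-same-entries (SumDecomposable⇒SumSplit (fromℕPerm ζ) a+b≡n same 0<a 0<b))) ,
  (λ (a , b , a+b≡n , 0<a , 0<b , _ , _ , _ , _ , same) →
     no-skew a (SkewSplit-same-entries (SkewDecomposable⇒SkewSplit (fromℕPerm ζ) a+b≡n same 0<a 0<b)))
  where
  same-entries : ∀ {i} → i < size ζ → entry (fromℕPerm ζ) i ≡ val ζ i
  same-entries = entry-fromℕPerm ζ
  SumSplit-same-entries : ∀ {k} → SumSplit (toℕPerm (fromℕPerm ζ)) k → SumSplit ζ k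
  SumSplit-same-entries (0<k , k<n , sep) = 0<k , k<n , λ i<k k≤i′ i′<n →
    subst₂ _<_ (same-entries (<-trans i<k k<n)) (same-entries i′<n) (sep i<k k≤i′ i′<n)
  SkewSplit-same-entries : ∀ {k} → SkewSplit (toℕPerm (fromℕPerm ζ)) k → SkewSplit ζ k
  SkewSplit-same-entries (0<k , k<n , sep) = 0<k , k<n , λ i<k k≤i′ i′<n →
    subst₂ _<_ (same-entries i′<n) (same-entries (<-trans i<k k<n)) (sep i<k k≤i′ i′<n)

private
  collision : ∀ {n} {A : Set} (g : Fin n → Fin n) → Injective _≡_ _≡_ g → ∀ {i j} → i ≢ j → g i ≡ g j → A
  collision g g-injective i≢j eq = ⊥-elim (i≢j (g-injective eq))

size2-exceptional : (g : Fin 2 → Fin 2) (g-injective : Injective _≡_ _≡_ g) → Exceptional (perm 2 g g-injective)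
size2-exceptional g g-injective with g 0F in e₀ | g 1F in e₁
... | 0F | 0F = collision g g-injective (λ ()) (trans e₀ (sym e₁))
... | 1F | 1F = collision g g-injective (λ ()) (trans e₀ (sym e₁))
... | 0F | 1F = inj₂ (inj₁ (refl , λ where
  0F → cong (suc ∘ toℕ) e₀
  1F → cong (suc ∘ toℕ) e₁))
... | 1F | 0F = inj₂ (inj₂ (inj₁ (refl , λ where
  0F → cong (suc ∘ toℕ) e₀
  1F → cong (suc ∘ toℕ) e₁)))

module _ (g : Fin 3 → Fin 3) (g-injective : Injective _≡_ _≡_ g) where

  private
    shape : ∀ {x y z} → g 0F ≡ x → g 1F ≡ y → g 2F ≡ z →
            oneLine (suc (toℕ x) ∷ suc (toℕ y) ∷ suc (toℕ z) ∷ []) (perm 3 g g-injective)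
    shape e₀ e₁ e₂ = refl , λ where
      0F → cong (suc ∘ toℕ) e₀
      1F → cong (suc ∘ toℕ) e₁
      2F → cong (suc ∘ toℕ) e₂

    entry≡ : ∀ {i x} → g i ≡ x → val (toℕPerm (perm 3 g g-injective)) (toℕ i) ≡ toℕ x
    entry≡ {i} eq = trans (extendℕ-toℕ (toℕ ∘ g) i) (cong toℕ eq)

  size3-admissible : ¬ Exceptional (perm 3 g g-injective) → Admissible (toℕPerm (perm 3 g g-injective))
  size3-admissible non-exceptional with g 0F in e₀ | g 1F in e₁ | g 2F in e₂
  ... | 0F | 1F | 2F = increasing refl (subst₂ _<_ (sym (entry≡ e₀)) (sym (entry≡ e₁)) (s≤s z≤n))
                                       (subst₂ _<_ (sym (entry≡ e₁)) (sym (entry≡ e₂)) (s≤s (s≤s z≤n)))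
  ... | 2F | 1F | 0F = decreasing refl (subst₂ _<_ (sym (entry≡ e₁)) (sym (entry≡ e₀)) (s≤s (s≤s z≤n)))
                                       (subst₂ _<_ (sym (entry≡ e₂)) (sym (entry≡ e₁)) (s≤s z≤n))
  ... | 0F | 2F | 1F = ⊥-elim (non-exceptional (inj₂ (inj₂ (inj₂ (inj₁ (shape e₀ e₁ e₂))))))
  ... | 1F | 0F | 2F = ⊥-elim (non-exceptional (inj₂ (inj₂ (inj₂ (inj₂ (inj₁ (shape e₀ e₁ e₂)))))))
  ... | 1F | 2F | 0F = ⊥-elim (non-exceptional (inj₂ (inj₂ (inj₂ (inj₂ (inj₂ (inj₁ (shape e₀ e₁ e₂))))))))
  ... | 2F | 0F | 1F = ⊥-elim (non-exceptional (inj₂ (inj₂ (inj₂ (inj₂ (inj₂ (inj₂ (shape e₀ e₁ e₂))))))))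
  ... | 0F | 0F | _  = collision g g-injective {0F} {1F} (λ ()) (trans e₀ (sym e₁))
  ... | 1F | 1F | _  = collision g g-injective {0F} {1F} (λ ()) (trans e₀ (sym e₁))
  ... | 2F | 2F | _  = collision g g-injective {0F} {1F} (λ ()) (trans e₀ (sym e₁))
  ... | 0F | _  | 0F = collision g g-injective {0F} {2F} (λ ()) (trans e₀ (sym e₂))
  ... | 1F | _  | 1F = collision g g-injective {0F} {2F} (λ ()) (trans e₀ (sym e₂))
  ... | 2F | _  | 2F = collision g g-injective {0F} {2F} (λ ()) (trans e₀ (sym e₂))
  ... | _  | 0F | 0F = collision g g-injective {1F} {2F} (λ ()) (trans e₁ (sym e₂))
  ... | _  | 1F | 1F = collision g g-injective {1F} {2F} (λ ()) (trans e₁ (sym e₂))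
  ... | _  | 2F | 2F = collision g g-injective {1F} {2F} (λ ()) (trans e₁ (sym e₂))

admissible : ∀ π → ¬ Exceptional π → 0 < len π → Admissible (toℕPerm π)
admissible (perm 1 g _) non-exceptional _ with g 0F in e₀
... | 0F = ⊥-elim (non-exceptional (inj₁ (refl , λ where 0F → cong (suc ∘ toℕ) e₀)))
admissible (perm 2 g g-injective) non-exceptional _ = ⊥-elim (non-exceptional (size2-exceptional g g-injective))
admissible (perm 3 g g-injective) non-exceptional _ = size3-admissible g g-injective non-exceptional
admissible (perm (suc (suc (suc (suc _)))) _ _) _ _ = long (s≤s (s≤s (s≤s (s≤s z≤n))))

lemma2p1 : (π : Perm) → ¬ Exceptional π →
    (ω : Perm) → Av π ω →
    Σ Perm (λ ζ → Av π ζ × Indecomposable ζ × ω ≼ ζ)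
lemma2p1 (perm zero _ _) _ ω avoids = ⊥-elim (avoids ((λ ()) , (λ ()) , (λ ())))
lemma2p1 π@(perm (suc _) _ _) non-exceptional ω avoids
  with extension (toℕPerm ω) (admissible π non-exceptional (s≤s z≤n)) (avoids ∘ ⊑⇒≼ {π} {ω})
... | ζ , ω⊑ζ , ζ-avoids , no-sum , no-skew =
  fromℕPerm ζ ,
  (λ π≼ζ → ζ-avoids (⊑-trans (≼⇒⊑ {π} {fromℕPerm ζ} π≼ζ) (fromℕPerm-⊑ ζ))) ,
  indecomposable ζ no-sum no-skew ,
  ⊑⇒≼ {ω} {fromℕPerm ζ} (⊑-trans ω⊑ζ (⊑-fromℕPerm ζ))
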